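{- Let $n\geqslant 1$ and $0\leqslant d\leqslant n-1$ be integers. Then \begin{align*} &\sum_{k=0}^{n-1}q^k\begin{bmatrix}2k\\ k+d\end{bmatrix}(-q^{k+1};q)_{n-1-k}\\ &\quad=\sum_{\substack{k=0\\ k\equiv n-d \bmod 2}}^{n-d}(-1)^{(n-d-k)/2}q^{3(n^2+k^2-d^2)/4-3nk/2+n-k}\frac{(1-q^k)(1+q^{n-k+1})}{(1-q^{2n-k+1})(1+q^n)}\begin{bmatrix}2n\\ k\end{bmatrix}, \end{align*} and \begin{align*} \sum_{k=0}^{n-1}q^k\begin{bmatrix}2k\\ k+d\end{bmatrix}(-q^{k+1};q)_{n-1-k}^2 =\sum_{k=d+1}^{n}\sum_{j=k+1}^{n+1}q^{(j^2-3j+k^2-k)/2-d^2+1}\,\frac{1+q^{j-1}}{1+q^n}\begin{bmatrix}2n\\ n-j+1\end{bmatrix}. \end{align*}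
   Context: For an indeterminate $q$: $(x;q)_0=1$ and $(x;q)_m=(1-x)(1-xq)\cdots(1-xq^{m-1})$ for $m\geq 1$. The $q$-binomial coefficient is $\begin{bmatrix}N\\ k\end{bmatrix}=\frac{(q;q)_N}{(q;q)_k(q;q)_{N-k}}$ if $0\leqslant k\leqslant N$ and $0$ otherwise. These are identities of rational functions in $q$. -}

module Defs where

open import Data.Nat as ℕ using (ℕ; zero; suc; _∸_; _≤?_)
open import Data.Integer as ℤ using (ℤ; +_; -[1+_])
open import Data.List using (List; []; _∷_; map)
open import Data.List.Relation.Unary.All using (All)
open import Relation.Binary.PropositionalEquality using (_≡_)
open import Relation.Nullary using (Dec; yes; no)

-- Polynomials in the indeterminate q with integer coefficients,
-- as coefficient lists (constant term first).

Poly : Set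
Poly = List ℤ

addP : Poly → Poly → Poly
addP [] p = p
addP (a ∷ p) [] = a ∷ p
addP (a ∷ p) (b ∷ r) = (a ℤ.+ b) ∷ addP p r

negP : Poly → Poly
negP = map (λ a → ℤ.- a)

scaleP : ℤ → Poly → Poly
scaleP c = map (c ℤ.*_)

mulP : Poly → Poly → Poly
mulP [] r = []
mulP (a ∷ p) r = addP (scaleP a r) (+ 0 ∷ mulP p r)

_≈P_ : Poly → Poly → Set
p ≈P r = All (_≡ + 0) (addP p (negP r))

-- Rational functions in q: formal quotients num/den of polynomials.
-- All denominators built below are nonzero polynomials.

record Frac : Set where
  constructor _⁄_
  field
    num : Poly
    den : Poly
open Frac public

infix 4 _≈F_
_≈F_ : Frac → Frac → Set
r ≈F s = mulP (num r) (den s) ≈P mulP (num s) (den r)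

fromℤ : ℤ → Frac
fromℤ c = (c ∷ []) ⁄ (+ 1 ∷ [])

0F 1F : Frac
0F = fromℤ (+ 0)
1F = fromℤ (+ 1)

infixl 6 _+F_ _-F_
infixl 7 _*F_ _÷F_
_+F_ : Frac → Frac → Frac
(a ⁄ b) +F (c ⁄ e) = addP (mulP a e) (mulP c b) ⁄ mulP b e

-F_ : Frac → Frac
-F (a ⁄ b) = negP a ⁄ b

_-F_ : Frac → Frac → Frac
r -F s = r +F (-F s)

_*F_ : Frac → Frac → Frac
(a ⁄ b) *F (c ⁄ e) = mulP a c ⁄ mulP b e

_÷F_ : Frac → Frac → Frac
(a ⁄ b) ÷F (c ⁄ e) = mulP a e ⁄ mulP b c

qF : Frac
qF = (+ 0 ∷ + 1 ∷ []) ⁄ (+ 1 ∷ [])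

qpowℕ : ℕ → Frac
qpowℕ zero = 1F
qpowℕ (suc m) = qpowℕ m *F qF

qpow : ℤ → Frac
qpow (+ m) = qpowℕ m
qpow -[1+ m ] = 1F ÷F qpowℕ (suc m)

sgn : ℕ → Frac
sgn zero = 1F
sgn (suc m) = -F sgn m

qPoch : Frac → ℕ → Frac
qPoch x zero = 1F
qPoch x (suc m) = qPoch x m *F (1F -F x *F qpowℕ m)

qBinom : ℕ → ℕ → Frac
qBinom N k with k ≤? N
... | yes _ = qPoch qF N ÷F (qPoch qF k *F qPoch qF (N ∸ k))
... | no _ = 0F

sumTo : ℕ → (ℕ → Frac) → Frac
sumTo zero f = 0F
sumTo (suc m) f = sumTo m f +F f m

-- Σ_{k=a}^{b} f k  (empty if a > b)
sumFromTo : ℕ → ℕ → (ℕ → Frac) → Frac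
sumFromTo a b f = sumTo (suc b ∸ a) (λ i → f (a ℕ.+ i))

when : {P : Set} → Dec P → Frac → Frac
when (yes _) r = r
when (no _) r = 0F

module Submission where

open import Defs
open import Data.Nat using (ℕ; _≤_; _∸_; _%_; ⌊_/2⌋)
open import Data.Nat as ℕ using ()
open import Data.Integer as ℤ using (ℤ; +_; _/ℕ_)
open import Data.Product using (_×_)

open import Data.Nat using (zero; suc; z≤n; s≤s)
import Data.Nat.Properties as ℕ
import Data.Nat.Tactic.RingSolver as ℕ-Solver
open import Data.Nat.DivMod using (m*n/n≡m)
open import Data.Integer using (_+_; _*_; -_; _-_; 0ℤ; 1ℤ)
import Data.Integer.Properties as ℤ
open import Data.Integer.Tactic.RingSolver using (solve-∀; solve)
open import Data.List using ([]; _∷_; length)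
open import Data.List.Relation.Unary.All as All using (All)
open import Data.Product using (_,_)
open import Data.Sum using (inj₁; inj₂)
open import Data.Empty using (⊥-elim)
open import Relation.Binary using (tri<; tri≈; tri>)
open import Relation.Binary.PropositionalEquality
open import Relation.Nullary using (¬_; Dec; yes; no)

-- Both sides are rational functions of q, so it suffices that the cross-multiplied difference,
-- a polynomial with integer coefficients, vanishes at every integer q = N ≥ 2. At such a point
-- everything evaluates to integers with nonvanishing denominators, the q-binomial coefficients
-- through the q-Pascal rule. Replacing the Pochhammer factor by f((-q^(k+1); q)_(n-1-k)) with
-- f = id or f = squaring, the left-hand sides A(n) satisfy A(d) = 0 and
-- A(n+1) = f(1 + q^n) A(n) + q^n [2n, n+d]. The right-hand sides, rewritten as sums of
-- binomials [2n, n + j] (using [2n, k] (1 - q^k) = [2n, 2n+1-k] (1 - q^(2n+1-k)) for the first),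
-- satisfy the same recurrence: summand by summand they differ from the recurrence by a
-- Wilf–Zeilberger certificate, which telescopes. Induction on n from n = d concludes.

eval : Poly → ℤ → ℤ
eval [] y = 0ℤ
eval (a ∷ p) y = a + y * eval p y

eval-addP : ∀ p r y → eval (addP p r) y ≡ eval p y + eval r y
eval-addP [] r y = sym (ℤ.+-identityˡ _)
eval-addP (a ∷ p) [] y = sym (ℤ.+-identityʳ _)
eval-addP (a ∷ p) (b ∷ r) y rewrite eval-addP p r y = lemma a b y (eval p y) (eval r y)
  where lemma : ∀ a b y u w → (a + b) + y * (u + w) ≡ (a + y * u) + (b + y * w)
        lemma = solve-∀

eval-negP : ∀ p y → eval (negP p) y ≡ - eval p y
eval-negP [] y = refl
eval-negP (a ∷ p) y rewrite eval-negP p y = lemma a y (eval p y)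
  where lemma : ∀ a y u → (- a) + y * (- u) ≡ - (a + y * u)
        lemma = solve-∀

eval-scaleP : ∀ c p y → eval (scaleP c p) y ≡ c * eval p y
eval-scaleP c [] y = sym (ℤ.*-zeroʳ c)
eval-scaleP c (a ∷ p) y rewrite eval-scaleP c p y = lemma c a y (eval p y)
  where lemma : ∀ c a y u → c * a + y * (c * u) ≡ c * (a + y * u)
        lemma = solve-∀

eval-mulP : ∀ p r y → eval (mulP p r) y ≡ eval p y * eval r y
eval-mulP [] r y = refl
eval-mulP (a ∷ p) r y
  rewrite eval-addP (scaleP a r) (+ 0 ∷ mulP p r) y | eval-scaleP a r y | eval-mulP p r y
  = lemma a y (eval p y) (eval r y)
  where lemma : ∀ a y u w → a * w + (0ℤ + y * (u * w)) ≡ (a + y * u) * w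
        lemma = solve-∀

*-≢0 : ∀ {a b : ℤ} → a ≢ 0ℤ → b ≢ 0ℤ → a * b ≢ 0ℤ
*-≢0 {a} a≢0 b≢0 ab≡0 with ℤ.i*j≡0⇒i≡0∨j≡0 a ab≡0
... | inj₁ a≡0 = a≢0 a≡0
... | inj₂ b≡0 = b≢0 b≡0

*-cancelˡ : ∀ {a b c : ℤ} → a ≢ 0ℤ → a * b ≡ a * c → b ≡ c
*-cancelˡ {a} {b} {c} a≢0 = ℤ.*-cancelˡ-≡ a b c {{ℤ.≢-nonZero a≢0}}

*-cancelʳ : ∀ {a b c : ℤ} → c ≢ 0ℤ → a * c ≡ b * c → a ≡ b
*-cancelʳ {a} {b} {c} c≢0 = ℤ.*-cancelʳ-≡ a b c {{ℤ.≢-nonZero c≢0}}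

certificate : ∀ {L R D u₁ v₁ u₂ v₂ : ℤ} (α β : ℤ) → D ≢ 0ℤ → u₁ ≡ v₁ → u₂ ≡ v₂ →
              (L - R) * D ≡ α * (u₁ - v₁) + β * (u₂ - v₂) → L ≡ R
certificate {L} {R} {D} {u₁} {_} {u₂} α β D≢0 refl refl witness =
  *-cancelʳ D≢0 (trans (lemma L R D) (trans (cong (_+ R * D) (trans witness (vanish α β u₁ u₂)))
                                            (ℤ.+-identityˡ (R * D))))
  where
  lemma : ∀ L R D → L * D ≡ (L - R) * D + R * D
  lemma = solve-∀
  vanish : ∀ α β u₁ u₂ → α * (u₁ - u₁) + β * (u₂ - u₂) ≡ 0ℤ
  vanish = solve-∀

certificate₁ : ∀ {L R D u v : ℤ} (α : ℤ) → D ≢ 0ℤ → u ≡ v → (L - R) * D ≡ α * (u - v) → L ≡ R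
certificate₁ {L} {R} {D} {u} α D≢0 refl witness =
  *-cancelʳ D≢0 (trans (lemma L R D) (trans (cong (_+ R * D) (trans witness (vanish α u))) (ℤ.+-identityˡ (R * D))))
  where
  lemma : ∀ L R D → L * D ≡ (L - R) * D + R * D
  lemma = solve-∀
  vanish : ∀ α u → α * (u - u) ≡ 0ℤ
  vanish = solve-∀

divLinear : ℤ → Poly → Poly
divLinear a [] = []
divLinear a (c ∷ []) = []
divLinear a (c ∷ c′ ∷ p) = eval (c′ ∷ p) a ∷ divLinear a (c′ ∷ p)

eval-divLinear : ∀ a p y → eval p y ≡ (y - a) * eval (divLinear a p) y + eval p a
eval-divLinear a [] y = lemma a y
  where lemma : ∀ a y → 0ℤ ≡ (y - a) * 0ℤ + 0ℤ
        lemma = solve-∀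
eval-divLinear a (c ∷ []) y = lemma a c y
  where lemma : ∀ a c y → c + y * 0ℤ ≡ (y - a) * 0ℤ + (c + a * 0ℤ)
        lemma = solve-∀
eval-divLinear a (c ∷ c′ ∷ p) y rewrite eval-divLinear a (c′ ∷ p) y =
  lemma a c y (eval (c′ ∷ p) a) (eval (divLinear a (c′ ∷ p)) y)
  where lemma : ∀ a c y u w → c + y * ((y - a) * w + u) ≡ (y - a) * (u + y * w) + (c + a * u)
        lemma = solve-∀

IsZero : Poly → Set
IsZero = All (_≡ 0ℤ)

c+a*0≡0⇒c≡0 : ∀ c a → c + a * 0ℤ ≡ 0ℤ → c ≡ 0ℤ
c+a*0≡0⇒c≡0 c a eq = trans (sym (trans (cong (λ u → c + u) (ℤ.*-zeroʳ a)) (ℤ.+-identityʳ c))) eq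

divLinear-isZero : ∀ a p → IsZero (divLinear a p) → eval p a ≡ 0ℤ → IsZero p
divLinear-isZero a [] _ _ = All.[]
divLinear-isZero a (c ∷ []) _ p[a]≡0 = c+a*0≡0⇒c≡0 c a p[a]≡0 All.∷ All.[]
divLinear-isZero a (c ∷ c′ ∷ p) (e All.∷ es) p[a]≡0 =
  c+a*0≡0⇒c≡0 c a (trans (cong (λ u → c + a * u) (sym e)) p[a]≡0) All.∷ divLinear-isZero a (c′ ∷ p) es e

length-divLinear : ∀ a c p → length (divLinear a (c ∷ p)) ≡ length p
length-divLinear a c [] = refl
length-divLinear a c (c′ ∷ p) = cong suc (length-divLinear a c′ p)

vanishesFrom⇒isZero : ∀ L p → length p ℕ.≤ L → (a : ℤ) → (∀ i → eval p (a + + i) ≡ 0ℤ) → IsZero p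
vanishesFrom⇒isZero L [] _ a zeros = All.[]
vanishesFrom⇒isZero L (c ∷ []) _ a zeros = c+a*0≡0⇒c≡0 c (a + + 0) (zeros 0) All.∷ All.[]
vanishesFrom⇒isZero (suc L) p@(c ∷ c′ ∷ p′) (s≤s |p|≤L) a zeros =
  divLinear-isZero a p (vanishesFrom⇒isZero L (divLinear a p) |p/|≤L (a + 1ℤ) quotientZeros) p[a]≡0
  where
  |p/|≤L : length (divLinear a p) ℕ.≤ L
  |p/|≤L = subst (ℕ._≤ L) (sym (length-divLinear a c (c′ ∷ p′))) |p|≤L
  p[a]≡0 : eval p a ≡ 0ℤ
  p[a]≡0 = trans (cong (eval p) (sym (ℤ.+-identityʳ a))) (zeros 0)
  quotientZeros : ∀ i → eval (divLinear a p) (a + 1ℤ + + i) ≡ 0ℤ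
  quotientZeros i = *-cancelˡ {+ suc i} (λ ()) (trans step (sym (ℤ.*-zeroʳ (+ suc i))))
    where
    y = a + 1ℤ + + i
    y-a : y - a ≡ + suc i
    y-a = lemma a (+ i)
      where lemma : ∀ a i → a + 1ℤ + i - a ≡ 1ℤ + i
            lemma = solve-∀
    p[y]≡0 : eval p y ≡ 0ℤ
    p[y]≡0 = trans (cong (eval p) (trans (ℤ.+-assoc a 1ℤ (+ i)) (cong (λ u → a + u) (sym (ℤ.pos-+ 1 i)))))
                   (zeros (suc i))
    step : + suc i * eval (divLinear a p) y ≡ 0ℤ
    step = begin
      + suc i * eval (divLinear a p) y               ≡⟨ sym (ℤ.+-identityʳ _) ⟩
      + suc i * eval (divLinear a p) y + 0ℤ          ≡⟨ cong₂ (λ u v → u * eval (divLinear a p) y + v) (sym y-a) (sym p[a]≡0) ⟩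
      (y - a) * eval (divLinear a p) y + eval p a    ≡⟨ sym (eval-divLinear a p y) ⟩
      eval p y                                       ≡⟨ p[y]≡0 ⟩
      0ℤ                                             ∎
      where open ≡-Reasoning

∑ : ℕ → (ℕ → ℤ) → ℤ
∑ zero f = 0ℤ
∑ (suc n) f = ∑ n f + f n

∑-cong : ∀ n {f g : ℕ → ℤ} → (∀ k → k ℕ.< n → f k ≡ g k) → ∑ n f ≡ ∑ n g
∑-cong zero eq = refl
∑-cong (suc n) eq = cong₂ _+_ (∑-cong n (λ k k<n → eq k (ℕ.m<n⇒m<1+n k<n))) (eq n ℕ.≤-refl)

∑-zero : ∀ n {f : ℕ → ℤ} → (∀ k → k ℕ.< n → f k ≡ 0ℤ) → ∑ n f ≡ 0ℤ
∑-zero zero eq = refl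
∑-zero (suc n) eq rewrite ∑-zero n (λ k k<n → eq k (ℕ.m<n⇒m<1+n k<n)) | eq n ℕ.≤-refl = refl

∑-+ : ∀ n (f g : ℕ → ℤ) → ∑ n (λ k → f k + g k) ≡ ∑ n f + ∑ n g
∑-+ zero f g = refl
∑-+ (suc n) f g rewrite ∑-+ n f g = lemma (∑ n f) (∑ n g) (f n) (g n)
  where lemma : ∀ a b c d → a + b + (c + d) ≡ a + c + (b + d)
        lemma = solve-∀

∑-*ˡ : ∀ n c (f : ℕ → ℤ) → ∑ n (λ k → c * f k) ≡ c * ∑ n f
∑-*ˡ zero c f = sym (ℤ.*-zeroʳ c)
∑-*ˡ (suc n) c f rewrite ∑-*ˡ n c f = sym (ℤ.*-distribˡ-+ c (∑ n f) (f n))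

∑-linear : ∀ n X c (f g : ℕ → ℤ) → ∑ n (λ k → X * (f k - c * g k)) ≡ X * (∑ n f - c * ∑ n g)
∑-linear zero X c f g = sym (trans (cong (λ u → X * (0ℤ - u)) (ℤ.*-zeroʳ c)) (ℤ.*-zeroʳ X))
∑-linear (suc n) X c f g rewrite ∑-linear n X c f g = lemma X c (∑ n f) (∑ n g) (f n) (g n)
  where lemma : ∀ X c a b e h → X * (a - c * b) + X * (e - c * h) ≡ X * ((a + e) - c * (b + h))
        lemma = solve-∀

∑-telescope : ∀ n (G : ℕ → ℤ) → ∑ n (λ k → G (suc k) - G k) ≡ G n - G 0
∑-telescope zero G = sym (ℤ.+-inverseʳ (G 0))
∑-telescope (suc n) G rewrite ∑-telescope n G = lemma (G n) (G 0) (G (suc n))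
  where lemma : ∀ a b c → a - b + (c - a) ≡ c - b
        lemma = solve-∀

∑-telescope′ : ∀ n (G : ℕ → ℤ) → ∑ n (λ k → G k - G (suc k)) ≡ G 0 - G n
∑-telescope′ zero G = sym (ℤ.+-inverseʳ (G 0))
∑-telescope′ (suc n) G rewrite ∑-telescope′ n G = lemma (G 0) (G n) (G (suc n))
  where lemma : ∀ a b c → a - b + (b - c) ≡ a - c
        lemma = solve-∀

∑-extend : ∀ m n {f : ℕ → ℤ} → m ℕ.≤ n → (∀ k → m ℕ.≤ k → k ℕ.< n → f k ≡ 0ℤ) → ∑ m f ≡ ∑ n f
∑-extend m zero z≤n zeros = refl
∑-extend m (suc n) {f} m≤1+n zeros with ℕ.m≤n⇒m<n∨m≡n m≤1+n
... | inj₂ refl = refl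
... | inj₁ (s≤s m≤n) rewrite zeros n m≤n ℕ.≤-refl =
  trans (∑-extend m n m≤n (λ k m≤k k<n → zeros k m≤k (ℕ.m<n⇒m<1+n k<n))) (sym (ℤ.+-identityʳ _))

∑-front : ∀ n (f : ℕ → ℤ) → ∑ (suc n) f ≡ f 0 + ∑ n (λ k → f (suc k))
∑-front zero f = trans (ℤ.+-identityˡ (f 0)) (sym (ℤ.+-identityʳ (f 0)))
∑-front (suc n) f rewrite ∑-front n f = ℤ.+-assoc (f 0) _ _

m+[1+n]≡o⇒m<o : ∀ {m o} n → m ℕ.+ suc n ≡ o → m ℕ.< o
m+[1+n]≡o⇒m<o {m} n eq = subst (m ℕ.<_) eq (ℕ.m<m+n m (s≤s z≤n))

⌊2*i/2⌋≡i : ∀ i → ⌊ 2 ℕ.* i /2⌋ ≡ i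
⌊2*i/2⌋≡i i = sym (trans (ℕ.n≡⌊n+n/2⌋ i) (cong (λ m → ⌊ i ℕ.+ m /2⌋) (sym (ℕ.+-identityʳ i))))

parity-suc : ∀ m → suc m % 2 ≢ m % 2
parity-suc zero ()
parity-suc (suc zero) ()
parity-suc (suc (suc m)) = parity-suc m

m<2*[1+⌊m/2⌋] : ∀ m → m ℕ.< 2 ℕ.* suc ⌊ m /2⌋
m<2*[1+⌊m/2⌋] zero = s≤s z≤n
m<2*[1+⌊m/2⌋] (suc zero) = s≤s (s≤s z≤n)
m<2*[1+⌊m/2⌋] (suc (suc m)) = subst (suc (suc m) ℕ.<_) (sym (lemma ⌊ m /2⌋)) (s≤s (s≤s (m<2*[1+⌊m/2⌋] m)))
  where lemma : ∀ h → 2 ℕ.* suc (suc h) ≡ suc (suc (2 ℕ.* suc h))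
        lemma = ℕ-Solver.solve-∀

-- Evaluating rational functions at an integer point

module Evaluation (x : ℤ) where

  record Evaluates (r : Frac) (a b : ℤ) : Set where
    constructor evaluates
    field
      den≢0 : eval (den r) x ≢ 0ℤ
      b≢0   : b ≢ 0ℤ
      cross : eval (num r) x * b ≡ a * eval (den r) x
  open Evaluates public

  EvaluatesToℤ : Frac → ℤ → Set
  EvaluatesToℤ r a = Evaluates r a 1ℤ

  1≢0 : 1ℤ ≢ 0ℤ
  1≢0 ()

  evaluates-+F : ∀ {r s a b c e} → Evaluates r a b → Evaluates s c e → Evaluates (r +F s) (a * e + c * b) (b * e)
  evaluates-+F {r} {s} {a} {b} {c} {e} (evaluates dr≢0 b≢0 vr) (evaluates ds≢0 e≢0 vs) =
    evaluates (λ z → *-≢0 dr≢0 ds≢0 (trans (sym (eval-mulP (den r) (den s) x)) z)) (*-≢0 b≢0 e≢0) cross′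
    where
    nr = eval (num r) x ; dr = eval (den r) x ; ns = eval (num s) x ; ds = eval (den s) x
    cross′ : eval (num (r +F s)) x * (b * e) ≡ (a * e + c * b) * eval (den (r +F s)) x
    cross′ rewrite eval-addP (mulP (num r) (den s)) (mulP (num s) (den r)) x
                 | eval-mulP (num r) (den s) x | eval-mulP (num s) (den r) x | eval-mulP (den r) (den s) x
      = begin
        (nr * ds + ns * dr) * (b * e)             ≡⟨ lemma₁ nr ds ns dr b e ⟩
        (nr * b) * (ds * e) + (ns * e) * (dr * b) ≡⟨ cong₂ (λ u w → u * (ds * e) + w * (dr * b)) vr vs ⟩
        (a * dr) * (ds * e) + (c * ds) * (dr * b) ≡⟨ lemma₂ a dr ds e c b ⟩
        (a * e + c * b) * (dr * ds)               ∎
      where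
      open ≡-Reasoning
      lemma₁ : ∀ nr ds ns dr b e → (nr * ds + ns * dr) * (b * e) ≡ (nr * b) * (ds * e) + (ns * e) * (dr * b)
      lemma₁ = solve-∀
      lemma₂ : ∀ a dr ds e c b → (a * dr) * (ds * e) + (c * ds) * (dr * b) ≡ (a * e + c * b) * (dr * ds)
      lemma₂ = solve-∀

  evaluates-*F : ∀ {r s a b c e} → Evaluates r a b → Evaluates s c e → Evaluates (r *F s) (a * c) (b * e)
  evaluates-*F {r} {s} {a} {b} {c} {e} (evaluates dr≢0 b≢0 vr) (evaluates ds≢0 e≢0 vs) =
    evaluates (λ z → *-≢0 dr≢0 ds≢0 (trans (sym (eval-mulP (den r) (den s) x)) z)) (*-≢0 b≢0 e≢0) cross′
    where
    nr = eval (num r) x ; dr = eval (den r) x ; ns = eval (num s) x ; ds = eval (den s) x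
    cross′ : eval (num (r *F s)) x * (b * e) ≡ (a * c) * eval (den (r *F s)) x
    cross′ rewrite eval-mulP (num r) (num s) x | eval-mulP (den r) (den s) x
      = begin
        (nr * ns) * (b * e) ≡⟨ interchange nr ns b e ⟩
        (nr * b) * (ns * e) ≡⟨ cong₂ _*_ vr vs ⟩
        (a * dr) * (c * ds) ≡⟨ interchange a dr c ds ⟩
        (a * c) * (dr * ds) ∎
      where
      open ≡-Reasoning
      interchange : ∀ p q r s → (p * q) * (r * s) ≡ (p * r) * (q * s)
      interchange = solve-∀

  evaluates--F : ∀ {r a b} → Evaluates r a b → Evaluates (-F r) (- a) b
  evaluates--F {r} {a} {b} (evaluates dr≢0 b≢0 vr) = evaluates dr≢0 b≢0 cross′
    where
    cross′ : eval (negP (num r)) x * b ≡ (- a) * eval (den r) x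
    cross′ rewrite eval-negP (num r) x = trans (sym (ℤ.neg-distribˡ-* (eval (num r) x) b))
                                          (trans (cong -_ vr) (ℤ.neg-distribˡ-* a (eval (den r) x)))

  evaluates-÷F : ∀ {r s a b c e} → Evaluates r a b → Evaluates s c e → c ≢ 0ℤ → Evaluates (r ÷F s) (a * e) (b * c)
  evaluates-÷F {r} {s} {a} {b} {c} {e} (evaluates dr≢0 b≢0 vr) (evaluates ds≢0 e≢0 vs) c≢0 =
    evaluates (λ z → *-≢0 dr≢0 ns≢0 (trans (sym (eval-mulP (den r) (num s) x)) z)) (*-≢0 b≢0 c≢0) cross′
    where
    nr = eval (num r) x ; dr = eval (den r) x ; ns = eval (num s) x ; ds = eval (den s) x
    ns≢0 : ns ≢ 0ℤ
    ns≢0 ns≡0 = *-≢0 c≢0 ds≢0 (trans (sym vs) (cong (_* e) ns≡0))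
    cross′ : eval (num (r ÷F s)) x * (b * c) ≡ (a * e) * eval (den (r ÷F s)) x
    cross′ rewrite eval-mulP (num r) (den s) x | eval-mulP (den r) (num s) x
      = begin
        (nr * ds) * (b * c) ≡⟨ lemma₁ nr ds b c ⟩
        (nr * b) * (c * ds) ≡⟨ cong₂ _*_ vr (sym vs) ⟩
        (a * dr) * (ns * e) ≡⟨ lemma₂ a dr ns e ⟩
        (a * e) * (dr * ns) ∎
      where
      open ≡-Reasoning
      lemma₁ : ∀ p q r s → (p * q) * (r * s) ≡ (p * r) * (s * q)
      lemma₁ = solve-∀
      lemma₂ : ∀ p q r s → (p * q) * (r * s) ≡ (p * s) * (q * r)
      lemma₂ = solve-∀

  evaluates-rescale : ∀ {r a b a′ b′} → Evaluates r a b → a * b′ ≡ a′ * b → b′ ≢ 0ℤ → Evaluates r a′ b′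
  evaluates-rescale {r} {a} {b} {a′} {b′} (evaluates dr≢0 b≢0 vr) ab′≡a′b b′≢0 =
    evaluates dr≢0 b′≢0 (*-cancelˡ b≢0 cross′)
    where
    nr = eval (num r) x ; dr = eval (den r) x
    cross′ : b * (nr * b′) ≡ b * (a′ * dr)
    cross′ = begin
      b * (nr * b′)  ≡⟨ lemma₁ b nr b′ ⟩
      (nr * b) * b′  ≡⟨ cong (_* b′) vr ⟩
      (a * dr) * b′  ≡⟨ lemma₂ a dr b′ ⟩
      (a * b′) * dr  ≡⟨ cong (_* dr) ab′≡a′b ⟩
      (a′ * b) * dr  ≡⟨ lemma₃ a′ b dr ⟩
      b * (a′ * dr)  ∎
      where
      open ≡-Reasoning
      lemma₁ : ∀ p q r → p * (q * r) ≡ (q * p) * r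
      lemma₁ = solve-∀
      lemma₂ : ∀ p q r → (p * q) * r ≡ (p * r) * q
      lemma₂ = solve-∀
      lemma₃ : ∀ p q r → (p * q) * r ≡ q * (p * r)
      lemma₃ = solve-∀

  evaluates-≡ : ∀ {r a b a′} → Evaluates r a b → a ≡ a′ → Evaluates r a′ b
  evaluates-≡ v refl = v

  eval-1∷[] : eval (1ℤ ∷ []) x ≢ 0ℤ
  eval-1∷[] eq = 1≢0 (trans (sym (cong (λ u → 1ℤ + u) (ℤ.*-zeroʳ x))) eq)

  evaluates-fromℤ : ∀ c → EvaluatesToℤ (fromℤ c) c
  evaluates-fromℤ c = evaluates eval-1∷[] 1≢0 (lemma c x)
    where lemma : ∀ c x → (c + x * 0ℤ) * 1ℤ ≡ c * (1ℤ + x * 0ℤ)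
          lemma = solve-∀

  evaluates-qF : EvaluatesToℤ qF x
  evaluates-qF = evaluates eval-1∷[] 1≢0 (lemma x)
    where lemma : ∀ x → (0ℤ + x * (1ℤ + x * 0ℤ)) * 1ℤ ≡ x * (1ℤ + x * 0ℤ)
          lemma = solve-∀

  evaluatesℤ-+F : ∀ {r s a c} → EvaluatesToℤ r a → EvaluatesToℤ s c → EvaluatesToℤ (r +F s) (a + c)
  evaluatesℤ-+F {a = a} {c} v w = evaluates-rescale (evaluates-+F v w) (lemma a c) 1≢0
    where lemma : ∀ a c → (a * 1ℤ + c * 1ℤ) * 1ℤ ≡ (a + c) * (1ℤ * 1ℤ)
          lemma = solve-∀

  evaluatesℤ-*F : ∀ {r s a c} → EvaluatesToℤ r a → EvaluatesToℤ s c → EvaluatesToℤ (r *F s) (a * c)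
  evaluatesℤ-*F {a = a} {c} v w = evaluates-rescale (evaluates-*F v w) (lemma a c) 1≢0
    where lemma : ∀ a c → (a * c) * 1ℤ ≡ (a * c) * (1ℤ * 1ℤ)
          lemma = solve-∀

  evaluatesℤ--F : ∀ {r s a c} → EvaluatesToℤ r a → EvaluatesToℤ s c → EvaluatesToℤ (r -F s) (a - c)
  evaluatesℤ--F v w = evaluatesℤ-+F v (evaluates--F w)

  evaluates-0F : ∀ {D} → D ≢ 0ℤ → Evaluates 0F 0ℤ D
  evaluates-0F D≢0 = evaluates-rescale (evaluates-fromℤ 0ℤ) refl D≢0

  evaluates-+F-sameDen : ∀ {r s a c D} → Evaluates r a D → Evaluates s c D → Evaluates (r +F s) (a + c) D
  evaluates-+F-sameDen {a = a} {c} {D} v w = evaluates-rescale (evaluates-+F v w) (lemma a c D) (b≢0 v)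
    where lemma : ∀ a c D → (a * D + c * D) * D ≡ (a + c) * (D * D)
          lemma = solve-∀

  evaluates-sumTo : ∀ {D} n {f : ℕ → Frac} {g : ℕ → ℤ} → D ≢ 0ℤ →
                    (∀ k → k ℕ.< n → Evaluates (f k) (g k) D) → Evaluates (sumTo n f) (∑ n g) D
  evaluates-sumTo zero D≢0 v = evaluates-0F D≢0
  evaluates-sumTo (suc n) D≢0 v =
    evaluates-+F-sameDen (evaluates-sumTo n D≢0 (λ k k<n → v k (ℕ.m<n⇒m<1+n k<n))) (v n ℕ.≤-refl)

  evaluates-when : ∀ {P : Set} {r a D} (P? : Dec P) → D ≢ 0ℤ →
                   (P → Evaluates r a D) → (¬ P → a ≡ 0ℤ) → Evaluates (when P? r) a D
  evaluates-when (yes p) D≢0 v _ = v p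
  evaluates-when (no ¬p) D≢0 _ a≡0 = evaluates-≡ (evaluates-0F D≢0) (sym (a≡0 ¬p))

  crossDifference : Frac → Frac → Poly
  crossDifference r s = addP (mulP (num r) (den s)) (negP (mulP (num s) (den r)))

  evaluates-crossDifference : ∀ {r s a b c e} → Evaluates r a b → Evaluates s c e → a * e ≡ c * b →
                              eval (crossDifference r s) x ≡ 0ℤ
  evaluates-crossDifference {r} {s} {a} {b} {c} {e} (evaluates dr≢0 b≢0 vr) (evaluates ds≢0 e≢0 vs) ae≡cb =
    *-cancelˡ (*-≢0 b≢0 e≢0) (trans cross′ (sym (ℤ.*-zeroʳ (b * e))))
    where
    nr = eval (num r) x ; dr = eval (den r) x ; ns = eval (num s) x ; ds = eval (den s) x
    cross′ : (b * e) * eval (crossDifference r s) x ≡ 0ℤ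
    cross′ rewrite eval-addP (mulP (num r) (den s)) (negP (mulP (num s) (den r))) x
                 | eval-negP (mulP (num s) (den r)) x | eval-mulP (num r) (den s) x | eval-mulP (num s) (den r) x
      = begin
        (b * e) * (nr * ds + - (ns * dr))         ≡⟨ lemma₁ b e nr ds ns dr ⟩
        (nr * b) * (e * ds) - (ns * e) * (b * dr) ≡⟨ cong₂ (λ u w → u * (e * ds) - w * (b * dr)) vr vs ⟩
        (a * dr) * (e * ds) - (c * ds) * (b * dr) ≡⟨ lemma₂ a dr e ds c b ⟩
        (a * e - c * b) * (dr * ds)               ≡⟨ cong (λ u → (u - c * b) * (dr * ds)) ae≡cb ⟩
        (c * b - c * b) * (dr * ds)               ≡⟨ lemma₃ (c * b) (dr * ds) ⟩
        0ℤ                                        ∎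
      where
      open ≡-Reasoning
      lemma₁ : ∀ b e nr ds ns dr → (b * e) * (nr * ds + - (ns * dr)) ≡ (nr * b) * (e * ds) - (ns * e) * (b * dr)
      lemma₁ = solve-∀
      lemma₂ : ∀ a dr e ds c b → (a * dr) * (e * ds) - (c * ds) * (b * dr) ≡ (a * e - c * b) * (dr * ds)
      lemma₂ = solve-∀
      lemma₃ : ∀ u w → (u - u) * w ≡ 0ℤ
      lemma₃ = solve-∀

  evaluates-sumSameParity : ∀ {D} m {T : ℕ → Frac} {F : ℕ → ℤ} → D ≢ 0ℤ →
    (∀ i → 2 ℕ.* i ℕ.≤ m → Evaluates (T (m ∸ 2 ℕ.* i)) (F i) D) →
    Evaluates (sumTo (suc m) (λ k → when (k % 2 ℕ.≟ m % 2) (T k))) (∑ (suc ⌊ m /2⌋) F) D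
  evaluates-sumSameParity zero D≢0 v =
    evaluates-+F-sameDen (evaluates-0F D≢0) (evaluates-when (0 ℕ.≟ 0) D≢0 (λ _ → v 0 z≤n) (λ ¬p → ⊥-elim (¬p refl)))
  evaluates-sumSameParity (suc zero) {T} D≢0 v =
    evaluates-+F-sameDen
      (evaluates-+F-sameDen (evaluates-0F D≢0) (evaluates-when {r = T 0} {a = 0ℤ} (0 ℕ.≟ 1) D≢0 (λ ()) (λ _ → refl)))
      (evaluates-when (1 ℕ.≟ 1) D≢0 (λ _ → v 0 z≤n) (λ ¬p → ⊥-elim (¬p refl)))
  evaluates-sumSameParity {D} (suc (suc m)) {T} {F} D≢0 v =
    evaluates-≡
      (evaluates-+F-sameDen
        (evaluates-+F-sameDen shorter
          (evaluates-when {a = 0ℤ} (suc m % 2 ℕ.≟ m % 2) D≢0 (λ p → ⊥-elim (parity-suc m p)) (λ _ → refl)))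
        (evaluates-when (m % 2 ℕ.≟ m % 2) D≢0 (λ _ → v 0 z≤n) (λ ¬p → ⊥-elim (¬p refl))))
      (trans (cong (_+ F 0) (ℤ.+-identityʳ rest)) (trans (ℤ.+-comm rest (F 0)) (sym (∑-front (suc ⌊ m /2⌋) F))))
    where
    rest = ∑ (suc ⌊ m /2⌋) (λ i → F (suc i))
    2*[1+i] : ∀ i → 2 ℕ.* suc i ≡ suc (suc (2 ℕ.* i))
    2*[1+i] = ℕ-Solver.solve-∀
    shorter : Evaluates (sumTo (suc m) (λ k → when (k % 2 ℕ.≟ m % 2) (T k))) (∑ (suc ⌊ m /2⌋) (λ i → F (suc i))) D
    shorter = evaluates-sumSameParity m D≢0 λ i 2i≤m →
      subst (λ k → Evaluates (T k) (F (suc i)) D) (cong (suc (suc m) ∸_) (2*[1+i] i))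
        (v (suc i) (subst (ℕ._≤ suc (suc m)) (sym (2*[1+i] i)) (s≤s (s≤s 2i≤m))))

-- q-analogues at the point q = N ≥ 2

module AtPoint (N' : ℕ) where

  N : ℕ
  N = suc (suc N')

  x : ℤ
  x = + N

  open Evaluation x public

  q^ : ℕ → ℤ
  q^ zero = 1ℤ
  q^ (suc m) = q^ m * x

  q^-+ : ∀ a b → q^ (a ℕ.+ b) ≡ q^ a * q^ b
  q^-+ zero b = sym (ℤ.*-identityˡ (q^ b))
  q^-+ (suc a) b rewrite q^-+ a b = lemma (q^ a) (q^ b) x
    where lemma : ∀ p q x → p * q * x ≡ p * x * q
          lemma = solve-∀

  q^-2* : ∀ n → q^ (2 ℕ.* n) ≡ q^ n * q^ n
  q^-2* n = trans (cong (λ m → q^ (n ℕ.+ m)) (ℕ.+-identityʳ n)) (q^-+ n n)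

  q^-1+2* : ∀ n → q^ (suc (2 ℕ.* n)) ≡ q^ n * q^ n * x
  q^-1+2* n = cong (_* x) (q^-2* n)

  q^-3* : ∀ e → q^ (3 ℕ.* e) ≡ q^ e * q^ e * q^ e
  q^-3* e = trans (cong (λ u → q^ (e ℕ.+ (e ℕ.+ u))) (ℕ.+-identityʳ e))
                  (trans (q^-+ e (e ℕ.+ e)) (trans (cong (q^ e *_) (q^-+ e e)) (sym (ℤ.*-assoc (q^ e) (q^ e) (q^ e)))))

  x*q^ : ∀ m → x * q^ m ≡ q^ (suc m)
  x*q^ m = ℤ.*-comm x (q^ m)

  q^≡N^ : ∀ m → q^ m ≡ + (N ℕ.^ m)
  q^≡N^ zero = refl
  q^≡N^ (suc m) rewrite q^≡N^ m = trans (sym (ℤ.pos-* (N ℕ.^ m) N)) (cong +_ (ℕ.*-comm (N ℕ.^ m) N))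

  q^≢0 : ∀ m → q^ m ≢ 0ℤ
  q^≢0 m eq = ℕ.<⇒≢ (ℕ.m^n>0 N m) (sym (ℤ.+-injective (trans (sym (q^≡N^ m)) eq)))

  1+q^≢0 : ∀ m → 1ℤ + q^ m ≢ 0ℤ
  1+q^≢0 m eq rewrite q^≡N^ m with eq
  ... | ()

  1-q^suc≢0 : ∀ m → 1ℤ - q^ (suc m) ≢ 0ℤ
  1-q^suc≢0 m eq = ℕ.<⇒≢ (ℕ.^-monoʳ-< N (s≤s (s≤s z≤n)) {0} {suc m} (s≤s z≤n))
                     (sym (ℤ.+-injective (trans (sym (q^≡N^ (suc m))) (trans (lemma (q^ (suc m))) (cong (λ u → 1ℤ - u) eq)))))
    where lemma : ∀ y → y ≡ 1ℤ - (1ℤ - y)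
          lemma = solve-∀

  1-x*q^≢0 : ∀ m → 1ℤ - x * q^ m ≢ 0ℤ
  1-x*q^≢0 m = subst (λ u → 1ℤ - u ≢ 0ℤ) (sym (x*q^ m)) (1-q^suc≢0 m)

  sign : ℕ → ℤ
  sign zero = 1ℤ
  sign (suc m) = - sign m

  poch : ℤ → ℕ → ℤ
  poch v zero = 1ℤ
  poch v (suc m) = poch v m * (1ℤ - v * q^ m)

  qfact : ℕ → ℤ
  qfact = poch x

  qfact≢0 : ∀ m → qfact m ≢ 0ℤ
  qfact≢0 zero ()
  qfact≢0 (suc m) = *-≢0 (qfact≢0 m) (1-x*q^≢0 m)

  binom : ℕ → ℕ → ℤ
  binom n zero = 1ℤ
  binom zero (suc k) = 0ℤ
  binom (suc n) (suc k) = binom n k + q^ (suc k) * binom n (suc k)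

  binom-over : ∀ n k → n ℕ.< k → binom n k ≡ 0ℤ
  binom-over zero (suc k) _ = refl
  binom-over (suc n) (suc k) (s≤s n<k) rewrite binom-over n k n<k | binom-over n (suc k) (ℕ.m<n⇒m<1+n n<k)
    = trans (ℤ.+-identityˡ _) (ℤ.*-zeroʳ (q^ (suc k)))

  *-binom-over : ∀ c n k → n ℕ.< k → c * binom n k ≡ 0ℤ
  *-binom-over c n k n<k = trans (cong (c *_) (binom-over n k n<k)) (ℤ.*-zeroʳ c)

  binom-qfact : ∀ n k → k ℕ.≤ n → binom n k * (qfact k * qfact (n ∸ k)) ≡ qfact n
  binom-qfact n zero _ = trans (ℤ.*-identityˡ _) (ℤ.*-identityˡ _)
  binom-qfact (suc n) (suc k) (s≤s k≤n) with ℕ.m≤n⇒m<n∨m≡n k≤n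
  ... | inj₂ refl rewrite ℕ.n∸n≡0 k | binom-over k (suc k) ℕ.≤-refl =
    trans (lemma (binom k k) (q^ (suc k)) (qfact k) (1ℤ - x * q^ k))
          (cong (_* (1ℤ - x * q^ k)) (subst (λ u → binom k k * (qfact k * qfact u) ≡ qfact k) (ℕ.n∸n≡0 k)
                                             (binom-qfact k k ℕ.≤-refl)))
    where lemma : ∀ a b p c → (a + b * 0ℤ) * ((p * c) * 1ℤ) ≡ (a * (p * 1ℤ)) * c
          lemma = solve-∀
  ... | inj₁ k<n = expand
    where
    m = n ∸ suc k
    n∸k≡1+m : n ∸ k ≡ suc m
    n∸k≡1+m = ℕ.+-∸-assoc 1 k<n
    left : binom n k * (qfact k * qfact (suc m)) ≡ qfact n
    left = subst (λ u → binom n k * (qfact k * qfact u) ≡ qfact n) n∸k≡1+m (binom-qfact n k (ℕ.<⇒≤ k<n))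
    right : binom n (suc k) * (qfact (suc k) * qfact m) ≡ qfact n
    right = binom-qfact n (suc k) k<n
    expand : binom (suc n) (suc k) * (qfact (suc k) * qfact (n ∸ k)) ≡ qfact (suc n)
    expand rewrite n∸k≡1+m = begin
      (binom n k + q^ (suc k) * binom n (suc k)) * ((qfact k * (1ℤ - x * q^ k)) * (qfact m * (1ℤ - x * q^ m)))
        ≡⟨ lemma₁ (binom n k) (q^ (suc k)) (binom n (suc k)) (qfact k) x (q^ k) (qfact m) (q^ m) ⟩
      (binom n k * (qfact k * (qfact m * (1ℤ - x * q^ m)))) * (1ℤ - x * q^ k)
        + (binom n (suc k) * ((qfact k * (1ℤ - x * q^ k)) * qfact m)) * (q^ (suc k) * (1ℤ - x * q^ m))
        ≡⟨ cong₂ (λ u w → u * (1ℤ - x * q^ k) + w * (q^ (suc k) * (1ℤ - x * q^ m))) left right ⟩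
      qfact n * (1ℤ - x * q^ k) + qfact n * (q^ (suc k) * (1ℤ - x * q^ m))
        ≡⟨ lemma₂ (qfact n) x (q^ k) (q^ m) ⟩
      qfact n * (1ℤ - x * (q^ (suc k) * q^ m))
        ≡⟨ cong (λ u → qfact n * (1ℤ - x * u)) (trans (sym (q^-+ (suc k) m)) (cong q^ (ℕ.m+[n∸m]≡n k<n))) ⟩
      qfact n * (1ℤ - x * q^ n) ∎
      where
      open ≡-Reasoning
      lemma₁ : ∀ a p b pk x y pm z → (a + p * b) * ((pk * (1ℤ - x * y)) * (pm * (1ℤ - x * z)))
               ≡ (a * (pk * (pm * (1ℤ - x * z)))) * (1ℤ - x * y) + (b * ((pk * (1ℤ - x * y)) * pm)) * (p * (1ℤ - x * z))
      lemma₁ = solve-∀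
      lemma₂ : ∀ pn x y z → pn * (1ℤ - x * y) + pn * ((y * x) * (1ℤ - x * z)) ≡ pn * (1ℤ - x * ((y * x) * z))
      lemma₂ = solve-∀

  -- [n, K+1] (1 - q^{K+1}) = [n, K] (1 - q^{n-K}), multiplied through by q^K
  binom-ratio : ∀ n K → binom n (suc K) * ((1ℤ - x * q^ K) * q^ K) ≡ binom n K * (q^ K - q^ n)
  binom-ratio n K with ℕ.<-cmp K n
  ... | tri< K<n _ _ = begin
    binom n (suc K) * ((1ℤ - x * q^ K) * q^ K)  ≡⟨ sym (ℤ.*-assoc (binom n (suc K)) (1ℤ - x * q^ K) (q^ K)) ⟩
    binom n (suc K) * (1ℤ - x * q^ K) * q^ K    ≡⟨ cong (_* q^ K) consecutive ⟩
    binom n K * (1ℤ - x * q^ m) * q^ K          ≡⟨ lemma (binom n K) x (q^ m) (q^ K) ⟩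
    binom n K * (q^ K - q^ K * x * q^ m)        ≡⟨ cong (λ u → binom n K * (q^ K - u)) q^n ⟩
    binom n K * (q^ K - q^ n)                   ∎
    where
    open ≡-Reasoning
    m = n ∸ suc K
    q^n : q^ K * x * q^ m ≡ q^ n
    q^n = trans (sym (q^-+ (suc K) m)) (cong q^ (ℕ.m+[n∸m]≡n K<n))
    consecutive : binom n (suc K) * (1ℤ - x * q^ K) ≡ binom n K * (1ℤ - x * q^ m)
    consecutive = *-cancelʳ (*-≢0 (qfact≢0 K) (qfact≢0 m)) (begin
      binom n (suc K) * (1ℤ - x * q^ K) * (qfact K * qfact m)
        ≡⟨ lemma₁ (binom n (suc K)) (qfact K) (1ℤ - x * q^ K) (qfact m) ⟩
      binom n (suc K) * (qfact (suc K) * qfact m)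
        ≡⟨ binom-qfact n (suc K) K<n ⟩
      qfact n
        ≡⟨ subst (λ u → binom n K * (qfact K * qfact u) ≡ qfact n) (ℕ.+-∸-assoc 1 K<n) (binom-qfact n K (ℕ.<⇒≤ K<n)) ⟨
      binom n K * (qfact K * qfact (suc m))
        ≡⟨ lemma₂ (binom n K) (qfact K) (1ℤ - x * q^ m) (qfact m) ⟨
      binom n K * (1ℤ - x * q^ m) * (qfact K * qfact m) ∎)
      where lemma₁ : ∀ q p c r → q * c * (p * r) ≡ q * ((p * c) * r)
            lemma₁ = solve-∀
            lemma₂ : ∀ q p c r → q * c * (p * r) ≡ q * (p * (r * c))
            lemma₂ = solve-∀
    lemma : ∀ q x y z → q * (1ℤ - x * y) * z ≡ q * (z - z * x * y)
    lemma = solve-∀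
  ... | tri≈ _ refl _ rewrite binom-over K (suc K) ℕ.≤-refl | ℤ.+-inverseʳ (q^ K) =
    trans (ℤ.*-zeroˡ ((1ℤ - x * q^ K) * q^ K)) (sym (ℤ.*-zeroʳ (binom K K)))
  ... | tri> _ _ n<K rewrite binom-over n (suc K) (ℕ.m<n⇒m<1+n n<K) | binom-over n K n<K =
    trans (ℤ.*-zeroˡ ((1ℤ - x * q^ K) * q^ K)) (sym (ℤ.*-zeroˡ (q^ K - q^ n)))

  binom-reflect : ∀ n k → (1ℤ - q^ k) * binom n k ≡ (1ℤ - q^ (suc n ∸ k)) * binom n (suc n ∸ k)
  binom-reflect n zero rewrite binom-over n (suc n) ℕ.≤-refl = sym (ℤ.*-zeroʳ (1ℤ - q^ (suc n)))
  binom-reflect n (suc k) with ℕ.<-cmp k n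
  ... | tri< k<n _ _ = *-cancelʳ (*-≢0 (qfact≢0 k) (qfact≢0 m)) (trans viaLower (sym viaUpper))
    where
    m = n ∸ suc k
    n∸k≡1+m : n ∸ k ≡ suc m
    n∸k≡1+m = ℕ.+-∸-assoc 1 k<n
    viaLower : (1ℤ - q^ (suc k)) * binom n (suc k) * (qfact k * qfact m) ≡ qfact n
    viaLower = trans (lemma (1ℤ - q^ (suc k)) (binom n (suc k)) (qfact k) (qfact m))
                     (trans (cong (λ u → binom n (suc k) * ((qfact k * (1ℤ - u)) * qfact m)) (sym (x*q^ k)))
                            (binom-qfact n (suc k) k<n))
      where lemma : ∀ c q p r → c * q * (p * r) ≡ q * ((p * c) * r)
            lemma = solve-∀
    viaUpper : (1ℤ - q^ (n ∸ k)) * binom n (n ∸ k) * (qfact k * qfact m) ≡ qfact n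
    viaUpper rewrite n∸k≡1+m =
      trans (lemma (1ℤ - q^ (suc m)) (binom n (suc m)) (qfact k) (qfact m))
        (trans (cong (λ u → binom n (suc m) * ((qfact m * (1ℤ - u)) * qfact k)) (sym (x*q^ m)))
          (subst (λ u → binom n u * (qfact u * qfact k) ≡ qfact n) n∸k≡1+m
            (subst (λ u → binom n (n ∸ k) * (qfact (n ∸ k) * qfact u) ≡ qfact n) (ℕ.m∸[m∸n]≡n (ℕ.<⇒≤ k<n))
              (binom-qfact n (n ∸ k) (ℕ.m∸n≤m n k)))))
      where lemma : ∀ c q p r → c * q * (p * r) ≡ q * ((r * c) * p)
            lemma = solve-∀
  ... | tri≈ _ refl _ rewrite ℕ.n∸n≡0 k | binom-over k (suc k) ℕ.≤-refl = ℤ.*-zeroʳ (1ℤ - q^ (suc k))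
  ... | tri> _ _ n<k rewrite binom-over n (suc k) (ℕ.m<n⇒m<1+n n<k) | ℕ.m≤n⇒m∸n≡0 (ℕ.<⇒≤ n<k) =
    ℤ.*-zeroʳ (1ℤ - q^ (suc k))

  binom-symmetric : ∀ n k → k ℕ.≤ n → binom n k ≡ binom n (n ∸ k)
  binom-symmetric n k k≤n = *-cancelʳ (*-≢0 (qfact≢0 k) (qfact≢0 (n ∸ k))) (begin
    binom n k * (qfact k * qfact (n ∸ k))              ≡⟨ binom-qfact n k k≤n ⟩
    qfact n                                            ≡⟨ binom-qfact n (n ∸ k) (ℕ.m∸n≤m n k) ⟨
    binom n (n ∸ k) * (qfact (n ∸ k) * qfact (n ∸ (n ∸ k)))
      ≡⟨ cong (λ u → binom n (n ∸ k) * u) (trans (cong (qfact (n ∸ k) *_) (cong qfact (ℕ.m∸[m∸n]≡n k≤n)))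
                                                 (ℤ.*-comm (qfact (n ∸ k)) (qfact k))) ⟩
    binom n (n ∸ k) * (qfact k * qfact (n ∸ k))        ∎)
    where open ≡-Reasoning

  evaluates-qpowℕ : ∀ m → EvaluatesToℤ (qpowℕ m) (q^ m)
  evaluates-qpowℕ zero = evaluates-fromℤ 1ℤ
  evaluates-qpowℕ (suc m) = evaluatesℤ-*F (evaluates-qpowℕ m) evaluates-qF

  evaluates-sgn : ∀ m → EvaluatesToℤ (sgn m) (sign m)
  evaluates-sgn zero = evaluates-fromℤ 1ℤ
  evaluates-sgn (suc m) = evaluates--F (evaluates-sgn m)

  evaluates-qPoch : ∀ {r v} → EvaluatesToℤ r v → ∀ m → EvaluatesToℤ (qPoch r m) (poch v m)
  evaluates-qPoch v zero = evaluates-fromℤ 1ℤ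
  evaluates-qPoch v (suc m) =
    evaluatesℤ-*F (evaluates-qPoch v m) (evaluatesℤ--F (evaluates-fromℤ 1ℤ) (evaluatesℤ-*F v (evaluates-qpowℕ m)))

  evaluates-qBinom : ∀ n k → EvaluatesToℤ (qBinom n k) (binom n k)
  evaluates-qBinom n k with k ℕ.≤? n
  ... | yes k≤n =
    evaluates-rescale
      (evaluates-÷F (evaluates-qPoch evaluates-qF n)
                    (evaluatesℤ-*F (evaluates-qPoch evaluates-qF k) (evaluates-qPoch evaluates-qF (n ∸ k)))
                    (*-≢0 (qfact≢0 k) (qfact≢0 (n ∸ k))))
      (trans (trans (ℤ.*-identityʳ _) (ℤ.*-identityʳ _))
             (sym (trans (cong (binom n k *_) (ℤ.*-identityˡ _)) (binom-qfact n k k≤n))))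
      1≢0
  ... | no k≰n = evaluates-≡ (evaluates-fromℤ 0ℤ) (sym (binom-over n k (ℕ.≰⇒> k≰n)))

  binom-ratio-row : ∀ n j → let Q = q^ n ; P = q^ j in
    binom (2 ℕ.* n) (suc (n ℕ.+ j)) * ((1ℤ - x * (Q * P)) * (Q * P)) ≡ binom (2 ℕ.* n) (n ℕ.+ j) * (Q * P - Q * Q)
  binom-ratio-row n j =
    subst (λ t → binom (2 ℕ.* n) (suc (n ℕ.+ j)) * ((1ℤ - x * t) * t) ≡ binom (2 ℕ.* n) (n ℕ.+ j) * (t - q^ n * q^ n))
          (q^-+ n j)
          (subst (λ t → binom (2 ℕ.* n) (suc (n ℕ.+ j)) * ((1ℤ - x * q^ (n ℕ.+ j)) * q^ (n ℕ.+ j))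
                        ≡ binom (2 ℕ.* n) (n ℕ.+ j) * (q^ (n ℕ.+ j) - t))
                 (q^-2* n) (binom-ratio (2 ℕ.* n) (n ℕ.+ j)))

  binom-ratio-row′ : ∀ n j → let Q = q^ n ; P = q^ j in
    binom (2 ℕ.* n) (suc (suc (n ℕ.+ j))) * ((1ℤ - x * (Q * P * x)) * (Q * P * x))
      ≡ binom (2 ℕ.* n) (suc (n ℕ.+ j)) * (Q * P * x - Q * Q)
  binom-ratio-row′ n j =
    subst (λ t → binom (2 ℕ.* n) (suc (suc (n ℕ.+ j))) * ((1ℤ - x * (t * x)) * (t * x))
                   ≡ binom (2 ℕ.* n) (suc (n ℕ.+ j)) * (t * x - q^ n * q^ n))
          (q^-+ n j)
          (subst (λ t → binom (2 ℕ.* n) (suc (suc (n ℕ.+ j))) * ((1ℤ - x * q^ (suc (n ℕ.+ j))) * q^ (suc (n ℕ.+ j)))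
                        ≡ binom (2 ℕ.* n) (suc (n ℕ.+ j)) * (q^ (suc (n ℕ.+ j)) - t))
                 (q^-2* n) (binom-ratio (2 ℕ.* n) (suc (n ℕ.+ j))))

  ratio-factor≢0 : ∀ n j → let Q = q^ n ; P = q^ j in (1ℤ - x * (Q * P)) * (Q * P) ≢ 0ℤ
  ratio-factor≢0 n j = subst (λ t → (1ℤ - x * t) * t ≢ 0ℤ) (q^-+ n j) (*-≢0 (1-x*q^≢0 (n ℕ.+ j)) (q^≢0 (n ℕ.+ j)))

  ratio-factor≢0′ : ∀ n j → let Q = q^ n ; P = q^ j in (1ℤ - x * (Q * P * x)) * (Q * P * x) ≢ 0ℤ
  ratio-factor≢0′ n j =
    subst (λ t → (1ℤ - x * (t * x)) * (t * x) ≢ 0ℤ) (q^-+ n j) (*-≢0 (1-x*q^≢0 (suc (n ℕ.+ j))) (q^≢0 (suc (n ℕ.+ j))))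

  pascal-row : ∀ n j → let Q = q^ n ; P = q^ j in
    binom (suc (2 ℕ.* n)) (suc (n ℕ.+ j)) ≡ binom (2 ℕ.* n) (n ℕ.+ j) + Q * P * x * binom (2 ℕ.* n) (suc (n ℕ.+ j))
  pascal-row n j = cong (λ t → binom (2 ℕ.* n) (n ℕ.+ j) + t * x * binom (2 ℕ.* n) (suc (n ℕ.+ j))) (q^-+ n j)

  pascal-row′ : ∀ n j → let Q = q^ n ; P = q^ j in
    binom (suc (2 ℕ.* n)) (suc (suc (n ℕ.+ j)))
      ≡ binom (2 ℕ.* n) (suc (n ℕ.+ j)) + Q * P * x * x * binom (2 ℕ.* n) (suc (suc (n ℕ.+ j)))
  pascal-row′ n j =
    cong (λ t → binom (2 ℕ.* n) (suc (n ℕ.+ j)) + t * x * x * binom (2 ℕ.* n) (suc (suc (n ℕ.+ j)))) (q^-+ n j)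

module LeftSides (N' d : ℕ) where
  open AtPoint N'

  -- f = id gives the first identity, f = squaring the second
  lhs : (ℤ → ℤ) → ℕ → ℤ
  lhs f n = ∑ n (λ k → q^ k * binom (2 ℕ.* k) (k ℕ.+ d) * f (poch (- q^ (k ℕ.+ 1)) (n ∸ 1 ∸ k)))

  poch-extend : ∀ n k → k ℕ.< n → poch (- q^ (k ℕ.+ 1)) (n ∸ k) ≡ poch (- q^ (k ℕ.+ 1)) (n ∸ 1 ∸ k) * (1ℤ + q^ n)
  poch-extend (suc n) k (s≤s k≤n) rewrite ℕ.+-∸-assoc 1 k≤n =
    cong (poch (- q^ (k ℕ.+ 1)) (n ∸ k) *_) (begin
      1ℤ - (- q^ (k ℕ.+ 1)) * q^ (n ∸ k) ≡⟨ lemma (q^ (k ℕ.+ 1)) (q^ (n ∸ k)) ⟩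
      1ℤ + q^ (k ℕ.+ 1) * q^ (n ∸ k)     ≡⟨ cong (λ u → 1ℤ + u) (sym (q^-+ (k ℕ.+ 1) (n ∸ k))) ⟩
      1ℤ + q^ (k ℕ.+ 1 ℕ.+ (n ∸ k))      ≡⟨ cong (λ u → 1ℤ + q^ u) exponent ⟩
      1ℤ + q^ (suc n)                    ∎)
    where
    open ≡-Reasoning
    lemma : ∀ a b → 1ℤ - (- a) * b ≡ 1ℤ + a * b
    lemma = solve-∀
    exponent : k ℕ.+ 1 ℕ.+ (n ∸ k) ≡ suc n
    exponent = trans (cong (ℕ._+ (n ∸ k)) (ℕ.+-comm k 1)) (cong suc (ℕ.m+[n∸m]≡n k≤n))

  lhs-suc : ∀ f → (∀ a b → f (a * b) ≡ f a * f b) → f 1ℤ ≡ 1ℤ →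
            ∀ n → lhs f (suc n) ≡ f (1ℤ + q^ n) * lhs f n + q^ n * binom (2 ℕ.* n) (n ℕ.+ d)
  lhs-suc f f-* f-1 n = cong₂ _+_ earlier last
    where
    term = λ n k → q^ k * binom (2 ℕ.* k) (k ℕ.+ d) * f (poch (- q^ (k ℕ.+ 1)) (n ∸ 1 ∸ k))
    earlier : ∑ n (term (suc n)) ≡ f (1ℤ + q^ n) * lhs f n
    earlier = trans (∑-cong n λ k k<n →
                       trans (cong (λ u → q^ k * binom (2 ℕ.* k) (k ℕ.+ d) * f u) (poch-extend n k k<n))
                             (trans (cong (q^ k * binom (2 ℕ.* k) (k ℕ.+ d) *_) (f-* _ _))
                                    (lemma (q^ k * binom (2 ℕ.* k) (k ℕ.+ d)) _ (f (1ℤ + q^ n)))))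
                    (∑-*ˡ n (f (1ℤ + q^ n)) (term n))
      where lemma : ∀ a b c → a * (b * c) ≡ c * (a * b)
            lemma = solve-∀
    last : term (suc n) n ≡ q^ n * binom (2 ℕ.* n) (n ℕ.+ d)
    last rewrite ℕ.n∸n≡0 n = trans (cong (q^ n * binom (2 ℕ.* n) (n ℕ.+ d) *_) f-1) (ℤ.*-identityʳ _)

  lhs-d : ∀ f → lhs f d ≡ 0ℤ
  lhs-d f = ∑-zero d λ k k<d → let P = f (poch (- q^ (k ℕ.+ 1)) (d ∸ 1 ∸ k)) in
    trans (cong (λ u → q^ k * u * P) (binom-over (2 ℕ.* k) (k ℕ.+ d) (2k<k+d k<d)))
          (trans (cong (_* P) (ℤ.*-zeroʳ (q^ k))) (ℤ.*-zeroˡ P))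
    where
    2k<k+d : ∀ {k} → k ℕ.< d → 2 ℕ.* k ℕ.< k ℕ.+ d
    2k<k+d {k} k<d = subst (ℕ._< k ℕ.+ d) (sym (double k)) (ℕ.+-monoʳ-< k k<d)
      where double : ∀ k → 2 ℕ.* k ≡ k ℕ.+ k
            double = ℕ-Solver.solve-∀

-- The first identity

-- With Q = q^n, P = q^(gap i), K = n + gap i and Yⱼ = [2n, K + j], the q-Pascal rule writes
-- [2n+2, K+2] in terms of Y₀, Y₁, Y₂, and binom-ratio-row relates consecutive Yⱼ.
wz-identity₁ : ∀ x Q P c Y₀ Y₁ Y₂ →
  Y₁ * ((1ℤ - x * (Q * P)) * (Q * P)) ≡ Y₀ * (Q * P - Q * Q) →
  Y₂ * ((1ℤ - x * (Q * P * x)) * (Q * P * x)) ≡ Y₁ * (Q * P * x - Q * Q) →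
  (1ℤ - x * (Q * P)) * (Q * P) * ((1ℤ - x * (Q * P * x)) * (Q * P * x)) ≢ 0ℤ →
  c * P * (1ℤ + x * P) * (Y₀ + Q * P * x * Y₁ + Q * P * x * x * (Y₁ + Q * P * x * x * Y₂))
    ≡ (1ℤ + x * Q) * (c * P * (1ℤ + x * P) * Y₁)
      + (c * x * x * x * P * P * P * Q * (1ℤ + x * Q) * Y₂ - - (c * Q * (1ℤ + x * Q)) * Y₀)
wz-identity₁ x Q P c Y₀ Y₁ Y₂ ratio₀ ratio₁ D≢0 =
  let a = c * P * (1ℤ + x * P)
      g = c * x * x * x * P * P * P * Q * (1ℤ + x * Q)
      K₁ = Q * P * x ; K₂ = Q * P * x * x
  in certificate ((a * (K₂ * K₂) - g) * ((1ℤ - x * (Q * P)) * (Q * P)))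
                 ((a * (K₁ + K₂) - (1ℤ + x * Q) * a) * ((1ℤ - x * K₁) * K₁) + (a * (K₂ * K₂) - g) * (K₁ - Q * Q))
                 D≢0 ratio₁ ratio₀ (solve (x ∷ Q ∷ P ∷ c ∷ Y₀ ∷ Y₁ ∷ Y₂ ∷ []))

module FirstIdentity (N' d : ℕ) where
  open AtPoint N'
  open LeftSides N' d

  -- in the i-th surviving term of the right-hand side, k = n - gap i
  gap expo : ℕ → ℕ
  gap i = d ℕ.+ 2 ℕ.* i
  expo i = 3 ℕ.* i ℕ.* i ℕ.+ 3 ℕ.* d ℕ.* i

  coeff : ℕ → ℤ
  coeff i = sign i * q^ (expo i ℕ.+ gap i) * (1ℤ + q^ (gap i ℕ.+ 1))

  rhs : ℕ → ℤ
  rhs n = ∑ (suc n) (λ i → coeff i * binom (2 ℕ.* n) (n ℕ.+ (gap i ℕ.+ 1)))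

  certCoeff : ℕ → ℕ → ℤ
  certCoeff n i = - (sign i * q^ (expo i) * q^ n * (1ℤ + x * q^ n))

  cert : ℕ → ℕ → ℤ
  cert n i = certCoeff n i * binom (2 ℕ.* n) (n ℕ.+ gap i)

  coeff-split : ∀ i → coeff i ≡ sign i * q^ (expo i) * q^ (gap i) * (1ℤ + x * q^ (gap i))
  coeff-split i = trans (cong₂ (λ u w → sign i * u * (1ℤ + w)) (q^-+ (expo i) (gap i)) (cong q^ (ℕ.+-comm (gap i) 1)))
                        (lemma (sign i) (q^ (expo i)) (q^ (gap i)) x)
    where lemma : ∀ s h v x → s * (h * v) * (1ℤ + v * x) ≡ s * h * v * (1ℤ + x * v)
          lemma = solve-∀

  q^-expo-suc : ∀ i → let P = q^ (gap i) in q^ (expo (suc i)) ≡ q^ (expo i) * (x * x * x * (P * P * P))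
  q^-expo-suc i = trans (cong q^ (expo-suc d i))
    (trans (q^-+ (expo i) (3 ℕ.+ 3 ℕ.* gap i)) (cong (q^ (expo i) *_) (trans (q^-+ 3 (3 ℕ.* gap i)) (cong₂ _*_ (q^3 x) (q^-3* (gap i))))))
    where
    expo-suc : ∀ d i → 3 ℕ.* suc i ℕ.* suc i ℕ.+ 3 ℕ.* d ℕ.* suc i
                       ≡ (3 ℕ.* i ℕ.* i ℕ.+ 3 ℕ.* d ℕ.* i) ℕ.+ (3 ℕ.+ 3 ℕ.* (d ℕ.+ 2 ℕ.* i))
    expo-suc = ℕ-Solver.solve-∀
    q^3 : ∀ x → 1ℤ * x * x * x ≡ x * x * x
    q^3 = solve-∀

  certCoeff-suc : ∀ n i → let Q = q^ n ; P = q^ (gap i) in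
    certCoeff n (suc i) ≡ sign i * q^ (expo i) * x * x * x * P * P * P * Q * (1ℤ + x * Q)
  certCoeff-suc n i = trans (cong (λ u → - (sign (suc i) * u * q^ n * (1ℤ + x * q^ n))) (q^-expo-suc i))
                            (lemma (sign i) (q^ (expo i)) x (q^ (gap i)) (q^ n))
    where lemma : ∀ s h x v Q → - ((- s) * (h * (x * x * x * (v * v * v))) * Q * (1ℤ + x * Q))
                                ≡ s * h * x * x * x * v * v * v * Q * (1ℤ + x * Q)
          lemma = solve-∀

  rhs-wz : ∀ n i → coeff i * binom (2 ℕ.* suc n) (suc n ℕ.+ (gap i ℕ.+ 1))
                   ≡ (1ℤ + x * q^ n) * (coeff i * binom (2 ℕ.* n) (n ℕ.+ (gap i ℕ.+ 1))) + (cert n (suc i) - cert n i)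
  rhs-wz n i = begin
    coeff i * binom (2 ℕ.* suc n) (suc n ℕ.+ (gap i ℕ.+ 1))
      ≡⟨ cong₂ _*_ (coeff-split i) (trans (cong₂ binom (index₁ n) (index₂ n d i)) pascal²) ⟩
    c * P * (1ℤ + x * P) * (Y₀ + Q * P * x * Y₁ + Q * P * x * x * (Y₁ + Q * P * x * x * Y₂))
      ≡⟨ wz-identity₁ x Q P c Y₀ Y₁ Y₂ (binom-ratio-row n j) (binom-ratio-row′ n j)
                      (*-≢0 (ratio-factor≢0 n j) (ratio-factor≢0′ n j)) ⟩
    (1ℤ + x * Q) * (c * P * (1ℤ + x * P) * Y₁) + (g * Y₂ - cert n i)
      ≡⟨ cong₂ (λ u v → (1ℤ + x * Q) * (u * binom (2 ℕ.* n) v) + (g * Y₂ - cert n i)) (sym (coeff-split i)) (index₃ n d i) ⟩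
    (1ℤ + x * Q) * (coeff i * binom (2 ℕ.* n) (n ℕ.+ (gap i ℕ.+ 1))) + (g * Y₂ - cert n i)
      ≡⟨ cong (λ u → (1ℤ + x * Q) * (coeff i * binom (2 ℕ.* n) (n ℕ.+ (gap i ℕ.+ 1))) + (u - cert n i)) (sym cert-suc) ⟩
    (1ℤ + x * Q) * (coeff i * binom (2 ℕ.* n) (n ℕ.+ (gap i ℕ.+ 1))) + (cert n (suc i) - cert n i) ∎
    where
    open ≡-Reasoning
    j = gap i
    Q = q^ n
    P = q^ j
    c = sign i * q^ (expo i)
    g = c * x * x * x * P * P * P * Q * (1ℤ + x * Q)
    Y₀ = binom (2 ℕ.* n) (n ℕ.+ j)
    Y₁ = binom (2 ℕ.* n) (suc (n ℕ.+ j))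
    Y₂ = binom (2 ℕ.* n) (suc (suc (n ℕ.+ j)))
    index₁ : ∀ n → 2 ℕ.* suc n ≡ suc (suc (2 ℕ.* n))
    index₁ = ℕ-Solver.solve-∀
    index₂ : ∀ n d i → suc n ℕ.+ ((d ℕ.+ 2 ℕ.* i) ℕ.+ 1) ≡ suc (suc (n ℕ.+ (d ℕ.+ 2 ℕ.* i)))
    index₂ = ℕ-Solver.solve-∀
    index₃ : ∀ n d i → suc (n ℕ.+ (d ℕ.+ 2 ℕ.* i)) ≡ n ℕ.+ ((d ℕ.+ 2 ℕ.* i) ℕ.+ 1)
    index₃ = ℕ-Solver.solve-∀
    index₄ : ∀ n d i → n ℕ.+ (d ℕ.+ 2 ℕ.* suc i) ≡ suc (suc (n ℕ.+ (d ℕ.+ 2 ℕ.* i)))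
    index₄ = ℕ-Solver.solve-∀
    pascal² : binom (suc (suc (2 ℕ.* n))) (suc (suc (n ℕ.+ j)))
              ≡ Y₀ + Q * P * x * Y₁ + Q * P * x * x * (Y₁ + Q * P * x * x * Y₂)
    pascal² = cong (λ t → Y₀ + t * x * Y₁ + t * x * x * (Y₁ + t * x * x * Y₂)) (q^-+ n j)
    cert-suc : cert n (suc i) ≡ g * Y₂
    cert-suc = cong₂ _*_ (certCoeff-suc n i) (cong (binom (2 ℕ.* n)) (index₄ n d i))

  rhs-suc : ∀ n → rhs (suc n) ≡ (1ℤ + q^ (suc n)) * (rhs n + q^ n * binom (2 ℕ.* n) (n ℕ.+ d))
  rhs-suc n = begin
    rhs (suc n)                                                   ≡⟨ cong (λ u → ∑ (suc n) term′ + u) last≡0 ⟩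
    ∑ (suc n) term′ + 0ℤ                                          ≡⟨ ℤ.+-identityʳ _ ⟩
    ∑ (suc n) term′                                               ≡⟨ ∑-cong (suc n) (λ i _ → rhs-wz n i) ⟩
    ∑ (suc n) (λ i → (1ℤ + x * q^ n) * term i + (cert n (suc i) - cert n i))
      ≡⟨ ∑-+ (suc n) (λ i → (1ℤ + x * q^ n) * term i) (λ i → cert n (suc i) - cert n i) ⟩
    ∑ (suc n) (λ i → (1ℤ + x * q^ n) * term i) + ∑ (suc n) (λ i → cert n (suc i) - cert n i)
      ≡⟨ cong₂ _+_ (∑-*ˡ (suc n) (1ℤ + x * q^ n) term) (∑-telescope (suc n) (cert n)) ⟩
    (1ℤ + x * q^ n) * rhs n + (cert n (suc n) - cert n 0)
      ≡⟨ cong₂ (λ u w → (1ℤ + x * q^ n) * rhs n + (u - w)) cert-end cert-start ⟩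
    (1ℤ + x * q^ n) * rhs n + (0ℤ - - (q^ n * (1ℤ + x * q^ n)) * binom (2 ℕ.* n) (n ℕ.+ d))
      ≡⟨ lemma x (q^ n) (rhs n) (binom (2 ℕ.* n) (n ℕ.+ d)) ⟩
    (1ℤ + q^ (suc n)) * (rhs n + q^ n * binom (2 ℕ.* n) (n ℕ.+ d)) ∎
    where
    open ≡-Reasoning
    term = λ i → coeff i * binom (2 ℕ.* n) (n ℕ.+ (gap i ℕ.+ 1))
    term′ = λ i → coeff i * binom (2 ℕ.* suc n) (suc n ℕ.+ (gap i ℕ.+ 1))
    last≡0 : term′ (suc n) ≡ 0ℤ
    last≡0 = *-binom-over (coeff (suc n)) _ _ (m+[1+n]≡o⇒m<o (d ℕ.+ suc n) (index n d))
      where index : ∀ n d → 2 ℕ.* suc n ℕ.+ suc (d ℕ.+ suc n) ≡ suc n ℕ.+ ((d ℕ.+ 2 ℕ.* suc n) ℕ.+ 1)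
            index = ℕ-Solver.solve-∀
    cert-end : cert n (suc n) ≡ 0ℤ
    cert-end = *-binom-over (certCoeff n (suc n)) _ _ (m+[1+n]≡o⇒m<o (d ℕ.+ suc n) (index n d))
      where index : ∀ n d → 2 ℕ.* n ℕ.+ suc (d ℕ.+ suc n) ≡ n ℕ.+ (d ℕ.+ 2 ℕ.* suc n)
            index = ℕ-Solver.solve-∀
    cert-start : cert n 0 ≡ - (q^ n * (1ℤ + x * q^ n)) * binom (2 ℕ.* n) (n ℕ.+ d)
    cert-start = cong₂ _*_ (cong -_ (trans (cong (λ e → 1ℤ * q^ e * q^ n * (1ℤ + x * q^ n)) (ℕ.*-zeroʳ (3 ℕ.* d)))
                                           (lemma₀ (q^ n) (1ℤ + x * q^ n))))
                           (cong (λ e → binom (2 ℕ.* n) (n ℕ.+ e)) (ℕ.+-identityʳ d))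
      where lemma₀ : ∀ a b → 1ℤ * 1ℤ * a * b ≡ a * b
            lemma₀ = solve-∀
    lemma : ∀ x q u b → (1ℤ + x * q) * u + (0ℤ - - (q * (1ℤ + x * q)) * b) ≡ (1ℤ + q * x) * (u + q * b)
    lemma = solve-∀

  rhs-d : rhs d ≡ 0ℤ
  rhs-d = ∑-zero (suc d) λ i _ → *-binom-over (coeff i) _ _ (m+[1+n]≡o⇒m<o (2 ℕ.* i) (index d i))
    where index : ∀ d i → 2 ℕ.* d ℕ.+ suc (2 ℕ.* i) ≡ d ℕ.+ ((d ℕ.+ 2 ℕ.* i) ℕ.+ 1)
          index = ℕ-Solver.solve-∀

  lhs≡rhs : ∀ r → (1ℤ + q^ (d ℕ.+ r)) * lhs (λ a → a) (d ℕ.+ r) ≡ rhs (d ℕ.+ r)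
  lhs≡rhs zero = subst (λ m → (1ℤ + q^ m) * lhs (λ a → a) m ≡ rhs m) (sym (ℕ.+-identityʳ d))
    (trans (cong ((1ℤ + q^ d) *_) (lhs-d (λ a → a))) (trans (ℤ.*-zeroʳ (1ℤ + q^ d)) (sym rhs-d)))
  lhs≡rhs (suc r) = subst (λ m → (1ℤ + q^ m) * lhs (λ a → a) m ≡ rhs m) (sym (ℕ.+-suc d r)) (begin
    (1ℤ + q^ (suc n)) * lhs (λ a → a) (suc n)
      ≡⟨ cong ((1ℤ + q^ (suc n)) *_) (lhs-suc (λ a → a) (λ _ _ → refl) refl n) ⟩
    (1ℤ + q^ (suc n)) * ((1ℤ + q^ n) * lhs (λ a → a) n + q^ n * binom (2 ℕ.* n) (n ℕ.+ d))
      ≡⟨ cong (λ u → (1ℤ + q^ (suc n)) * (u + q^ n * binom (2 ℕ.* n) (n ℕ.+ d))) (lhs≡rhs r) ⟩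
    (1ℤ + q^ (suc n)) * (rhs n + q^ n * binom (2 ℕ.* n) (n ℕ.+ d))
      ≡⟨ rhs-suc n ⟨
    rhs (suc n) ∎)
    where
    open ≡-Reasoning
    n = d ℕ.+ r

-- with both sides moved so that no subtraction occurs in ℕ
numerator₁ : ∀ (A B C E F G W : ℕ) → 3 ℕ.* A ℕ.+ 3 ℕ.* B ℕ.+ 4 ℕ.* F ≡ 3 ℕ.* C ℕ.+ 6 ℕ.* E ℕ.+ 4 ℕ.* G ℕ.+ 4 ℕ.* W →
             (+ 3) * (+ A + + B - + C) - (+ 6) * + E + (+ 4) * + F - (+ 4) * + G ≡ + (4 ℕ.* W)
numerator₁ A B C E F G W eq = begin
  (+ 3) * (+ A + + B - + C) - (+ 6) * + E + (+ 4) * + F - (+ 4) * + G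
    ≡⟨ lemma (+ A) (+ B) (+ C) (+ E) (+ F) (+ G) (+ W) ⟩
  (+ 4) * + W + ((+ 3) * + A + (+ 3) * + B + (+ 4) * + F - ((+ 3) * + C + (+ 6) * + E + (+ 4) * + G + (+ 4) * + W))
    ≡⟨ cong₂ (λ u v → (+ 4) * + W + (u - v)) (sym lhs-cast) (sym rhs-cast) ⟩
  (+ 4) * + W + (+ (3 ℕ.* A ℕ.+ 3 ℕ.* B ℕ.+ 4 ℕ.* F) - + (3 ℕ.* C ℕ.+ 6 ℕ.* E ℕ.+ 4 ℕ.* G ℕ.+ 4 ℕ.* W))
    ≡⟨ cong (λ u → (+ 4) * + W + (+ u - + (3 ℕ.* C ℕ.+ 6 ℕ.* E ℕ.+ 4 ℕ.* G ℕ.+ 4 ℕ.* W))) eq ⟩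
  (+ 4) * + W + (+ (3 ℕ.* C ℕ.+ 6 ℕ.* E ℕ.+ 4 ℕ.* G ℕ.+ 4 ℕ.* W) - + (3 ℕ.* C ℕ.+ 6 ℕ.* E ℕ.+ 4 ℕ.* G ℕ.+ 4 ℕ.* W))
    ≡⟨ cong (λ u → (+ 4) * + W + u) (ℤ.+-inverseʳ (+ (3 ℕ.* C ℕ.+ 6 ℕ.* E ℕ.+ 4 ℕ.* G ℕ.+ 4 ℕ.* W))) ⟩
  (+ 4) * + W + 0ℤ
    ≡⟨ trans (ℤ.+-identityʳ _) (sym (ℤ.pos-* 4 W)) ⟩
  + (4 ℕ.* W) ∎
  where
  open ≡-Reasoning
  lemma : ∀ a b c e f g w → (+ 3) * (a + b - c) - (+ 6) * e + (+ 4) * f - (+ 4) * g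
          ≡ (+ 4) * w + ((+ 3) * a + (+ 3) * b + (+ 4) * f - ((+ 3) * c + (+ 6) * e + (+ 4) * g + (+ 4) * w))
  lemma = solve-∀
  lhs-cast : + (3 ℕ.* A ℕ.+ 3 ℕ.* B ℕ.+ 4 ℕ.* F) ≡ (+ 3) * + A + (+ 3) * + B + (+ 4) * + F
  lhs-cast = trans (ℤ.pos-+ (3 ℕ.* A ℕ.+ 3 ℕ.* B) (4 ℕ.* F))
    (cong₂ _+_ (trans (ℤ.pos-+ (3 ℕ.* A) (3 ℕ.* B)) (cong₂ _+_ (ℤ.pos-* 3 A) (ℤ.pos-* 3 B))) (ℤ.pos-* 4 F))
  rhs-cast : + (3 ℕ.* C ℕ.+ 6 ℕ.* E ℕ.+ 4 ℕ.* G ℕ.+ 4 ℕ.* W) ≡ (+ 3) * + C + (+ 6) * + E + (+ 4) * + G + (+ 4) * + W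
  rhs-cast = trans (ℤ.pos-+ (3 ℕ.* C ℕ.+ 6 ℕ.* E ℕ.+ 4 ℕ.* G) (4 ℕ.* W))
    (cong₂ _+_ (trans (ℤ.pos-+ (3 ℕ.* C ℕ.+ 6 ℕ.* E) (4 ℕ.* G))
      (cong₂ _+_ (trans (ℤ.pos-+ (3 ℕ.* C) (6 ℕ.* E)) (cong₂ _+_ (ℤ.pos-* 3 C) (ℤ.pos-* 6 E))) (ℤ.pos-* 4 G)))
      (ℤ.pos-* 4 W))

[4*w]/4≡w : ∀ w → + (4 ℕ.* w) /ℕ 4 ≡ + w
[4*w]/4≡w w = cong +_ (trans (cong (ℕ._/ 4) (ℕ.*-comm 4 w)) (m*n/n≡m w 4))

firstLhs firstRhs : ℕ → ℕ → Frac
firstRhsTerm : ℕ → ℕ → ℕ → Frac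
firstLhs n d = sumTo n (λ k → qpowℕ k *F qBinom (2 ℕ.* k) (k ℕ.+ d) *F qPoch (-F qpowℕ (k ℕ.+ 1)) (n ∸ 1 ∸ k))
firstRhsTerm n d k =
  sgn ⌊ (n ∸ d ∸ k) /2⌋
  *F qpow (((+ 3) * (+ (n ℕ.* n) + + (k ℕ.* k) - + (d ℕ.* d)) - (+ 6) * + (n ℕ.* k) + (+ 4) * + n - (+ 4) * + k) /ℕ 4)
  *F (((1F -F qpowℕ k) *F (1F +F qpowℕ (n ∸ k ℕ.+ 1))) ÷F ((1F -F qpowℕ (2 ℕ.* n ∸ k ℕ.+ 1)) *F (1F +F qpowℕ n)))
  *F qBinom (2 ℕ.* n) k
firstRhs n d = sumFromTo 0 (n ∸ d) (λ k → when (k % 2 ℕ.≟ (n ∸ d) % 2) (firstRhsTerm n d k))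

module FirstIdentityAtPoint (N' n d : ℕ) where
  open AtPoint N'
  open LeftSides N' d
  open FirstIdentity N' d

  rhsValue : ℕ → ℤ
  rhsValue i = coeff i * binom (2 ℕ.* n) (n ℕ.+ (gap i ℕ.+ 1))

  firstExponent≡ : ∀ i k → n ≡ d ℕ.+ (k ℕ.+ 2 ℕ.* i) →
    ((+ 3) * (+ (n ℕ.* n) + + (k ℕ.* k) - + (d ℕ.* d)) - (+ 6) * + (n ℕ.* k) + (+ 4) * + n - (+ 4) * + k) /ℕ 4
      ≡ + (expo i ℕ.+ gap i)
  firstExponent≡ i k refl =
    trans (cong (_/ℕ 4) (numerator₁ (n ℕ.* n) (k ℕ.* k) (d ℕ.* d) (n ℕ.* k) n k (expo i ℕ.+ gap i) (arithmetic d k i)))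
          ([4*w]/4≡w (expo i ℕ.+ gap i))
    where
    arithmetic : ∀ d k i → let n = d ℕ.+ (k ℕ.+ 2 ℕ.* i) in
      3 ℕ.* (n ℕ.* n) ℕ.+ 3 ℕ.* (k ℕ.* k) ℕ.+ 4 ℕ.* n
        ≡ 3 ℕ.* (d ℕ.* d) ℕ.+ 6 ℕ.* (n ℕ.* k) ℕ.+ 4 ℕ.* k ℕ.+ 4 ℕ.* ((3 ℕ.* i ℕ.* i ℕ.+ 3 ℕ.* d ℕ.* i) ℕ.+ (d ℕ.+ 2 ℕ.* i))
    arithmetic = ℕ-Solver.solve-∀

  n∸d∸k≡2i : ∀ i k → n ≡ d ℕ.+ (k ℕ.+ 2 ℕ.* i) → n ∸ d ∸ k ≡ 2 ℕ.* i
  n∸d∸k≡2i i k refl = trans (cong (_∸ k) (ℕ.m+n∸m≡n d (k ℕ.+ 2 ℕ.* i))) (ℕ.m+n∸m≡n k (2 ℕ.* i))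

  n∸k≡gap : ∀ i k → n ≡ d ℕ.+ (k ℕ.+ 2 ℕ.* i) → n ∸ k ≡ gap i
  n∸k≡gap i k refl = trans (cong (_∸ k) (index d k i)) (ℕ.m+n∸m≡n k (gap i))
    where index : ∀ d k i → d ℕ.+ (k ℕ.+ 2 ℕ.* i) ≡ k ℕ.+ (d ℕ.+ 2 ℕ.* i)
          index = ℕ-Solver.solve-∀

  1+2n∸k≡n+gap+1 : ∀ i k → n ≡ d ℕ.+ (k ℕ.+ 2 ℕ.* i) → suc (2 ℕ.* n) ∸ k ≡ n ℕ.+ (gap i ℕ.+ 1)
  1+2n∸k≡n+gap+1 i k refl = trans (cong (_∸ k) (index d k i)) (ℕ.m+n∸m≡n k (n ℕ.+ (gap i ℕ.+ 1)))
    where index : ∀ d k i → suc (2 ℕ.* (d ℕ.+ (k ℕ.+ 2 ℕ.* i)))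
                            ≡ k ℕ.+ ((d ℕ.+ (k ℕ.+ 2 ℕ.* i)) ℕ.+ ((d ℕ.+ 2 ℕ.* i) ℕ.+ 1))
          index = ℕ-Solver.solve-∀

  2n∸k+1≡n+gap+1 : ∀ i k → n ≡ d ℕ.+ (k ℕ.+ 2 ℕ.* i) → 2 ℕ.* n ∸ k ℕ.+ 1 ≡ n ℕ.+ (gap i ℕ.+ 1)
  2n∸k+1≡n+gap+1 i k eq@refl =
    trans (sym (ℕ.+-∸-comm 1 k≤2n)) (trans (cong (_∸ k) (ℕ.+-comm (2 ℕ.* n) 1)) (1+2n∸k≡n+gap+1 i k eq))
    where
    index : ∀ d k i → k ℕ.+ (d ℕ.+ (d ℕ.+ (k ℕ.+ 4 ℕ.* i))) ≡ 2 ℕ.* (d ℕ.+ (k ℕ.+ 2 ℕ.* i))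
    index = ℕ-Solver.solve-∀
    k≤2n : k ℕ.≤ 2 ℕ.* n
    k≤2n = subst (k ℕ.≤_) (index d k i) (ℕ.m≤m+n k _)

  evaluates-firstRhsTerm : ∀ i k → n ≡ d ℕ.+ (k ℕ.+ 2 ℕ.* i) → Evaluates (firstRhsTerm n d k) (rhsValue i) (1ℤ + q^ n)
  evaluates-firstRhsTerm i k refl = evaluates-rescale value values≡ (1+q^≢0 n)
    where
    X = n ℕ.+ (gap i ℕ.+ 1)
    n∸d∸k = n∸d∸k≡2i i k refl
    n∸k = n∸k≡gap i k refl
    1+2n∸k = 1+2n∸k≡n+gap+1 i k refl
    2n∸k+1 = 2n∸k+1≡n+gap+1 i k refl
    numerator = (1ℤ - q^ k) * (1ℤ + q^ (n ∸ k ℕ.+ 1))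
    denominator = (1ℤ - q^ (2 ℕ.* n ∸ k ℕ.+ 1)) * (1ℤ + q^ n)
    value = evaluates-*F
              (evaluates-*F
                (evaluates-*F
                  (evaluates-≡ (evaluates-sgn ⌊ (n ∸ d ∸ k) /2⌋) (cong sign (trans (cong ⌊_/2⌋ n∸d∸k) (⌊2*i/2⌋≡i i))))
                  (subst (λ e → EvaluatesToℤ (qpow e) (q^ (expo i ℕ.+ gap i))) (sym (firstExponent≡ i k refl))
                         (evaluates-qpowℕ (expo i ℕ.+ gap i))))
                (evaluates-÷F
                  (evaluatesℤ-*F (evaluatesℤ--F (evaluates-fromℤ 1ℤ) (evaluates-qpowℕ k))
                                 (evaluatesℤ-+F (evaluates-fromℤ 1ℤ) (evaluates-qpowℕ (n ∸ k ℕ.+ 1))))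
                  (evaluatesℤ-*F (evaluatesℤ--F (evaluates-fromℤ 1ℤ) (evaluates-qpowℕ (2 ℕ.* n ∸ k ℕ.+ 1)))
                                 (evaluatesℤ-+F (evaluates-fromℤ 1ℤ) (evaluates-qpowℕ n)))
                  (*-≢0 (subst (λ e → 1ℤ - q^ e ≢ 0ℤ) (ℕ.+-comm 1 (2 ℕ.* n ∸ k)) (1-q^suc≢0 (2 ℕ.* n ∸ k))) (1+q^≢0 n))))
              (evaluates-qBinom (2 ℕ.* n) k)
    reflect : (1ℤ - q^ k) * binom (2 ℕ.* n) k ≡ (1ℤ - q^ X) * binom (2 ℕ.* n) X
    reflect = subst (λ u → (1ℤ - q^ k) * binom (2 ℕ.* n) k ≡ (1ℤ - q^ u) * binom (2 ℕ.* n) u)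
                    1+2n∸k (binom-reflect (2 ℕ.* n) k)
    values≡ : sign i * q^ (expo i ℕ.+ gap i) * (numerator * 1ℤ) * binom (2 ℕ.* n) k * (1ℤ + q^ n)
            ≡ rhsValue i * (1ℤ * 1ℤ * (1ℤ * denominator) * 1ℤ)
    values≡ rewrite n∸k | 2n∸k+1 =
      trans (regroup (sign i) (q^ (expo i ℕ.+ gap i)) (1ℤ + q^ (gap i ℕ.+ 1)) (1ℤ - q^ k) (binom (2 ℕ.* n) k) (1ℤ + q^ n))
            (trans (cong (sign i * q^ (expo i ℕ.+ gap i) * (1ℤ + q^ (gap i ℕ.+ 1)) * (1ℤ + q^ n) *_) reflect)
                   (regroup′ (sign i) (q^ (expo i ℕ.+ gap i)) (1ℤ + q^ (gap i ℕ.+ 1)) (1ℤ - q^ X) (binom (2 ℕ.* n) X) (1ℤ + q^ n)))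
      where
      regroup : ∀ s p a u b D → s * p * (u * a * 1ℤ) * b * D ≡ s * p * a * D * (u * b)
      regroup = solve-∀
      regroup′ : ∀ s p a u b D → s * p * a * D * (u * b) ≡ s * p * a * b * (1ℤ * 1ℤ * (1ℤ * (u * D)) * 1ℤ)
      regroup′ = solve-∀

  evaluates-firstRhs : d ℕ.≤ n → Evaluates (firstRhs n d) (∑ (suc ⌊ (n ∸ d) /2⌋) rhsValue) (1ℤ + q^ n)
  evaluates-firstRhs d≤n = evaluates-sumSameParity (n ∸ d) (1+q^≢0 n) λ i 2i≤n∸d →
    evaluates-firstRhsTerm i (n ∸ d ∸ 2 ℕ.* i)
      (sym (trans (cong (d ℕ.+_) (ℕ.m∸n+n≡m 2i≤n∸d)) (ℕ.m+[n∸m]≡n d≤n)))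

  evaluates-firstLhs : EvaluatesToℤ (firstLhs n d) (lhs (λ a → a) n)
  evaluates-firstLhs = evaluates-sumTo n 1≢0 λ k _ →
    evaluatesℤ-*F (evaluatesℤ-*F (evaluates-qpowℕ k) (evaluates-qBinom (2 ℕ.* k) (k ℕ.+ d)))
                  (evaluates-qPoch (evaluates--F (evaluates-qpowℕ (k ℕ.+ 1))) (n ∸ 1 ∸ k))

  -- only the terms with 2i ≤ n - d survive in rhs n
  rhs≡∑rhsValue : d ℕ.≤ n → rhs n ≡ ∑ (suc ⌊ (n ∸ d) /2⌋) rhsValue
  rhs≡∑rhsValue d≤n = sym (∑-extend (suc ⌊ (n ∸ d) /2⌋) (suc n) (s≤s (ℕ.≤-trans (ℕ.⌊n/2⌋≤n (n ∸ d)) (ℕ.m∸n≤m n d)))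
    λ i i>⌊[n∸d]/2⌋ _ → *-binom-over (coeff i) (2 ℕ.* n) _ (2n<n+gap+1 i i>⌊[n∸d]/2⌋))
    where
    2n<n+gap+1 : ∀ i → suc ⌊ (n ∸ d) /2⌋ ℕ.≤ i → 2 ℕ.* n ℕ.< n ℕ.+ (gap i ℕ.+ 1)
    2n<n+gap+1 i i>⌊[n∸d]/2⌋ = subst (ℕ._< n ℕ.+ (gap i ℕ.+ 1)) (sym 2n≡n+[d+[n∸d]])
      (ℕ.+-monoʳ-< n (subst (d ℕ.+ (n ∸ d) ℕ.<_) (sym (ℕ.+-assoc d (2 ℕ.* i) 1))
        (ℕ.+-monoʳ-< d (ℕ.<-trans n∸d<2i (ℕ.≤-reflexive (ℕ.+-comm 1 (2 ℕ.* i)))))))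
      where
      n∸d<2i : n ∸ d ℕ.< 2 ℕ.* i
      n∸d<2i = ℕ.<-≤-trans (m<2*[1+⌊m/2⌋] (n ∸ d)) (ℕ.*-monoʳ-≤ 2 i>⌊[n∸d]/2⌋)
      2n≡n+[d+[n∸d]] : 2 ℕ.* n ≡ n ℕ.+ (d ℕ.+ (n ∸ d))
      2n≡n+[d+[n∸d]] = cong (n ℕ.+_) (trans (ℕ.+-identityʳ n) (sym (ℕ.m+[n∸m]≡n d≤n)))

  firstIdentity-at : d ℕ.≤ n → eval (crossDifference (firstLhs n d) (firstRhs n d)) x ≡ 0ℤ
  firstIdentity-at d≤n = evaluates-crossDifference evaluates-firstLhs (evaluates-firstRhs d≤n) (begin
    lhs (λ a → a) n * (1ℤ + q^ n)            ≡⟨ ℤ.*-comm (lhs (λ a → a) n) (1ℤ + q^ n) ⟩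
    (1ℤ + q^ n) * lhs (λ a → a) n            ≡⟨ subst (λ m → (1ℤ + q^ m) * lhs (λ a → a) m ≡ rhs m)
                                                      (ℕ.m+[n∸m]≡n d≤n) (lhs≡rhs (n ∸ d)) ⟩
    rhs n                                    ≡⟨ rhs≡∑rhsValue d≤n ⟩
    ∑ (suc ⌊ (n ∸ d) /2⌋) rhsValue           ≡⟨ ℤ.*-identityʳ _ ⟨
    ∑ (suc ⌊ (n ∸ d) /2⌋) rhsValue * 1ℤ      ∎)
    where open ≡-Reasoning

-- The second identity

-- With Q = q^n, P = q^m, K = n + m and Zⱼ = [2n, K + j]: the q-Pascal rule gives the rows
-- 2n+1 and 2n+2, and binom-ratio-row relates consecutive Zⱼ.
wz-identity₂ : ∀ x Q P p Z₀ Z₁ Z₂ →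
  Z₁ * ((1ℤ - x * (Q * P)) * (Q * P)) ≡ Z₀ * (Q * P - Q * Q) →
  Z₂ * ((1ℤ - x * (Q * P * x)) * (Q * P * x)) ≡ Z₁ * (Q * P * x - Q * Q) →
  (1ℤ - x * (Q * P)) * (Q * P) * ((1ℤ - x * (Q * P * x)) * (Q * P * x)) ≢ 0ℤ →
  (1ℤ - Q * Q * x) * (p * P * (1ℤ + P * x) * ((Z₀ + Q * P * x * Z₁) + Q * P * x * x * (Z₁ + Q * P * x * x * Z₂))
                      - (1ℤ + x * Q) * (1ℤ + Q) * (p * P * (1ℤ + P * x) * Z₁))
    ≡ p * P * Q * (1ℤ + x * Q) * (P * P * x * x * x - 1ℤ) * (Z₁ + Q * P * x * x * Z₂)
      - p * Q * (1ℤ + x * Q) * (P * P * x - 1ℤ) * (Z₀ + Q * P * x * Z₁)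
wz-identity₂ x Q P p Z₀ Z₁ Z₂ ratio₀ ratio₁ D≢0 =
  let a = p * P * (1ℤ + P * x)
      g₁ = p * P * Q * (1ℤ + x * Q) * (P * P * x * x * x - 1ℤ)
      g₀ = p * Q * (1ℤ + x * Q) * (P * P * x - 1ℤ)
      K₁ = Q * P * x ; K₂ = Q * P * x * x
      top = (1ℤ - Q * Q * x) * (a * (K₂ * K₂)) - g₁ * K₂
  in certificate (top * ((1ℤ - x * (Q * P)) * (Q * P)))
                 (((1ℤ - Q * Q * x) * (a * (K₁ + K₂) - (1ℤ + x * Q) * (1ℤ + Q) * a) - (g₁ - g₀ * K₁)) * ((1ℤ - x * K₁) * K₁)
                  + top * (K₁ - Q * Q))
                 D≢0 ratio₁ ratio₀ (solve (x ∷ Q ∷ P ∷ p ∷ Z₀ ∷ Z₁ ∷ Z₂ ∷ []))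

wz-identity₃ : ∀ x Q P r Z₁ Z₂ →
  Z₂ * ((1ℤ - x * (Q * P)) * (Q * P)) ≡ Z₁ * (Q * P - Q * Q) →
  (1ℤ - x * (Q * P)) * (Q * P) ≢ 0ℤ →
  r * (1ℤ - P * P * x) * (Z₁ + Q * P * x * Z₂) ≡ (1ℤ - Q * Q * x) * (r * Z₁ - r * P * P * x * Z₂)
wz-identity₃ x Q P r Z₁ Z₂ ratio D≢0 =
  certificate₁ (r * (1ℤ - P * P * x) * (Q * P * x) + (1ℤ - Q * Q * x) * (r * P * P * x)) D≢0 ratio
               (solve (x ∷ Q ∷ P ∷ r ∷ Z₁ ∷ Z₂ ∷ []))

triangular : ℕ → ℕ
triangular zero = 0
triangular (suc m) = triangular m ℕ.+ m

triangular-suc+triangular : ∀ j → triangular (suc j) ℕ.+ triangular j ≡ j ℕ.* j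
triangular-suc+triangular zero = refl
triangular-suc+triangular (suc j) =
  trans (lemma (triangular j) j) (trans (cong (λ u → u ℕ.+ suc j ℕ.+ j) (triangular-suc+triangular j)) (lemma′ j))
  where
  lemma : ∀ c j → c ℕ.+ j ℕ.+ suc j ℕ.+ (c ℕ.+ j) ≡ (c ℕ.+ j ℕ.+ c) ℕ.+ suc j ℕ.+ j
  lemma = ℕ-Solver.solve-∀
  lemma′ : ∀ j → j ℕ.* j ℕ.+ suc j ℕ.+ j ≡ suc j ℕ.* suc j
  lemma′ = ℕ-Solver.solve-∀

triangular-mono : ∀ {a b} → a ℕ.≤ b → triangular a ℕ.≤ triangular b
triangular-mono {zero} _ = z≤n
triangular-mono {suc a} {suc b} (s≤s a≤b) = ℕ.+-mono-≤ (triangular-mono a≤b) a≤b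

m*m≡2*triangular+m : ∀ m → m ℕ.* m ≡ 2 ℕ.* triangular m ℕ.+ m
m*m≡2*triangular+m m = trans (sym (triangular-suc+triangular m)) (lemma (triangular m) m)
  where lemma : ∀ c m → c ℕ.+ m ℕ.+ c ≡ 2 ℕ.* c ℕ.+ m
        lemma = ℕ-Solver.solve-∀

d*d≤triangular+triangular : ∀ d k m → d ℕ.< k → d ℕ.< m → d ℕ.* d ℕ.≤ triangular m ℕ.+ triangular k
d*d≤triangular+triangular d k m d<k d<m = ℕ.≤-trans (ℕ.≤-reflexive (sym (triangular-suc+triangular d)))
  (ℕ.+-mono-≤ (triangular-mono d<m) (ℕ.≤-trans (triangular-mono (ℕ.n≤1+n d)) (triangular-mono d<k)))

module SecondIdentity (N' d : ℕ) where
  open AtPoint N'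
  open LeftSides N' d

  weight : ℕ → ℤ
  weight m = q^ (triangular m) * (1ℤ + q^ m)

  -- ∑_{m ≥ k} q^C(m,2) (1 + q^m) [2n, n+m]; the terms vanish from m = n + 1 on
  tail : ℕ → ℕ → ℤ
  tail n k = ∑ (n ℕ.+ 2) (λ s → weight (k ℕ.+ s) * binom (2 ℕ.* n) (n ℕ.+ (k ℕ.+ s)))

  growth oddFactor : ℕ → ℤ
  growth n = (1ℤ + x * q^ n) * (1ℤ + q^ n)
  oddFactor n = 1ℤ - q^ (suc (2 ℕ.* n))

  tailCertCoeff : ℕ → ℕ → ℤ
  tailCertCoeff n zero = 0ℤ
  tailCertCoeff n (suc m) = q^ (triangular m) * q^ n * (1ℤ + x * q^ n) * (q^ (suc (2 ℕ.* m)) - 1ℤ)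

  tailCert : ℕ → ℕ → ℤ
  tailCert n m = tailCertCoeff n m * binom (suc (2 ℕ.* n)) (n ℕ.+ m)

  weight-suc : ∀ m → weight (suc m) ≡ q^ (triangular m) * q^ m * (1ℤ + q^ m * x)
  weight-suc m = cong (_* (1ℤ + q^ m * x)) (q^-+ (triangular m) m)

  tailCertCoeff-suc-suc : ∀ n m → let Q = q^ n ; P = q^ m in
    tailCertCoeff n (suc (suc m)) ≡ q^ (triangular m) * P * Q * (1ℤ + x * Q) * (P * P * x * x * x - 1ℤ)
  tailCertCoeff-suc-suc n m =
    trans (cong₂ (λ u v → u * q^ n * (1ℤ + x * q^ n) * (v - 1ℤ)) (q^-+ (triangular m) m) (q^-1+2* (suc m)))
          (lemma (q^ (triangular m)) (q^ m) (q^ n) x)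
    where lemma : ∀ p w Q x → p * w * Q * (1ℤ + x * Q) * (w * x * (w * x) * x - 1ℤ)
                              ≡ p * w * Q * (1ℤ + x * Q) * (w * w * x * x * x - 1ℤ)
          lemma = solve-∀

  tail-wz : ∀ n m →
    oddFactor n * (weight (suc m) * binom (2 ℕ.* suc n) (suc n ℕ.+ suc m) - growth n * (weight (suc m) * binom (2 ℕ.* n) (n ℕ.+ suc m)))
      ≡ tailCert n (suc (suc m)) - tailCert n (suc m)
  tail-wz n m = begin
    oddFactor n * (weight (suc m) * binom (2 ℕ.* suc n) (suc n ℕ.+ suc m) - growth n * (weight (suc m) * binom (2 ℕ.* n) (n ℕ.+ suc m)))
      ≡⟨ cong₂ (λ u v → u * (v * binom (2 ℕ.* suc n) (suc n ℕ.+ suc m) - growth n * (v * binom (2 ℕ.* n) (n ℕ.+ suc m))))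
               oddFactor≡ (weight-suc m) ⟩
    (1ℤ - Q * Q * x) * (a * binom (2 ℕ.* suc n) (suc n ℕ.+ suc m) - growth n * (a * binom (2 ℕ.* n) (n ℕ.+ suc m)))
      ≡⟨ cong₂ (λ u v → (1ℤ - Q * Q * x) * (a * u - growth n * (a * v)))
               (trans (cong₂ binom (index₁ n) (index₂ n m)) pascal²) (cong (binom (2 ℕ.* n)) (ℕ.+-suc n m)) ⟩
    (1ℤ - Q * Q * x) * (a * ((Z₀ + Q * P * x * Z₁) + Q * P * x * x * (Z₁ + Q * P * x * x * Z₂)) - (1ℤ + x * Q) * (1ℤ + Q) * (a * Z₁))
      ≡⟨ wz-identity₂ x Q P (q^ (triangular m)) Z₀ Z₁ Z₂ (binom-ratio-row n m) (binom-ratio-row′ n m)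
                      (*-≢0 (ratio-factor≢0 n m) (ratio-factor≢0′ n m)) ⟩
    g₁ * (Z₁ + Q * P * x * x * Z₂) - g₀ * (Z₀ + Q * P * x * Z₁)
      ≡⟨ cong₂ _-_ (sym cert-next) (sym cert-this) ⟩
    tailCert n (suc (suc m)) - tailCert n (suc m) ∎
    where
    open ≡-Reasoning
    Q = q^ n
    P = q^ m
    a = q^ (triangular m) * P * (1ℤ + P * x)
    g₁ = q^ (triangular m) * P * Q * (1ℤ + x * Q) * (P * P * x * x * x - 1ℤ)
    g₀ = q^ (triangular m) * Q * (1ℤ + x * Q) * (P * P * x - 1ℤ)
    Z₀ = binom (2 ℕ.* n) (n ℕ.+ m)
    Z₁ = binom (2 ℕ.* n) (suc (n ℕ.+ m))
    Z₂ = binom (2 ℕ.* n) (suc (suc (n ℕ.+ m)))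
    index₁ : ∀ n → 2 ℕ.* suc n ≡ suc (suc (2 ℕ.* n))
    index₁ = ℕ-Solver.solve-∀
    index₂ : ∀ n m → suc n ℕ.+ suc m ≡ suc (suc (n ℕ.+ m))
    index₂ = ℕ-Solver.solve-∀
    index₃ : ∀ n m → n ℕ.+ suc (suc m) ≡ suc (suc (n ℕ.+ m))
    index₃ = ℕ-Solver.solve-∀
    oddFactor≡ : oddFactor n ≡ 1ℤ - Q * Q * x
    oddFactor≡ = cong (λ u → 1ℤ - u) (q^-1+2* n)
    pascal² : binom (suc (suc (2 ℕ.* n))) (suc (suc (n ℕ.+ m)))
              ≡ (Z₀ + Q * P * x * Z₁) + Q * P * x * x * (Z₁ + Q * P * x * x * Z₂)
    pascal² = cong (λ t → (Z₀ + t * x * Z₁) + t * x * x * (Z₁ + t * x * x * Z₂)) (q^-+ n m)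
    cert-this : tailCert n (suc m) ≡ g₀ * (Z₀ + Q * P * x * Z₁)
    cert-this = cong₂ _*_ (cong (λ u → q^ (triangular m) * Q * (1ℤ + x * Q) * (u - 1ℤ)) (q^-1+2* m))
                          (trans (cong (binom (suc (2 ℕ.* n))) (ℕ.+-suc n m)) (pascal-row n m))
    cert-next : tailCert n (suc (suc m)) ≡ g₁ * (Z₁ + Q * P * x * x * Z₂)
    cert-next = cong₂ _*_ (tailCertCoeff-suc-suc n m) (trans (cong (binom (suc (2 ℕ.* n))) (index₃ n m)) (pascal-row′ n m))

  tail-suc : ∀ n k → oddFactor n * (tail (suc n) (suc k) - growth n * tail n (suc k)) ≡ 0ℤ - tailCert n (suc k)
  tail-suc n k = begin
    oddFactor n * (tail (suc n) (suc k) - growth n * tail n (suc k))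
      ≡⟨ cong (λ u → oddFactor n * (u - growth n * tail n (suc k)))
              (trans (cong (λ u → ∑ (n ℕ.+ 2) term′ + u) last≡0) (ℤ.+-identityʳ (∑ (n ℕ.+ 2) term′))) ⟩
    oddFactor n * (∑ (n ℕ.+ 2) term′ - growth n * ∑ (n ℕ.+ 2) term)
      ≡⟨ ∑-linear (n ℕ.+ 2) (oddFactor n) (growth n) term′ term ⟨
    ∑ (n ℕ.+ 2) (λ s → oddFactor n * (term′ s - growth n * term s))
      ≡⟨ ∑-cong (n ℕ.+ 2) (λ s _ → trans (tail-wz n (k ℕ.+ s))
                                         (cong (λ u → tailCert n (suc u) - tailCert n (suc (k ℕ.+ s))) (sym (ℕ.+-suc k s)))) ⟩
    ∑ (n ℕ.+ 2) (λ s → cert (suc s) - cert s)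
      ≡⟨ ∑-telescope (n ℕ.+ 2) cert ⟩
    cert (n ℕ.+ 2) - cert 0
      ≡⟨ cong₂ _-_ cert-end (cong (λ u → tailCert n (suc u)) (ℕ.+-identityʳ k)) ⟩
    0ℤ - tailCert n (suc k) ∎
    where
    open ≡-Reasoning
    term′ = λ s → weight (suc k ℕ.+ s) * binom (2 ℕ.* suc n) (suc n ℕ.+ (suc k ℕ.+ s))
    term = λ s → weight (suc k ℕ.+ s) * binom (2 ℕ.* n) (n ℕ.+ (suc k ℕ.+ s))
    cert = λ s → tailCert n (suc k ℕ.+ s)
    last≡0 : term′ (n ℕ.+ 2) ≡ 0ℤ
    last≡0 = *-binom-over (weight (suc k ℕ.+ (n ℕ.+ 2))) _ _ (m+[1+n]≡o⇒m<o (suc k) (index n k))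
      where index : ∀ n k → 2 ℕ.* suc n ℕ.+ suc (suc k) ≡ suc n ℕ.+ (suc k ℕ.+ (n ℕ.+ 2))
            index = ℕ-Solver.solve-∀
    cert-end : cert (n ℕ.+ 2) ≡ 0ℤ
    cert-end = *-binom-over (tailCertCoeff n (suc k ℕ.+ (n ℕ.+ 2))) _ _ (m+[1+n]≡o⇒m<o (suc k) (index n k))
      where index : ∀ n k → suc (2 ℕ.* n) ℕ.+ suc (suc k) ≡ n ℕ.+ (suc k ℕ.+ (n ℕ.+ 2))
            index = ℕ-Solver.solve-∀

  rhs : ℕ → ℤ
  rhs n = ∑ (suc n) (λ t → q^ (triangular (suc (d ℕ.+ t))) * tail n (suc (d ℕ.+ t)))

  edge : ℕ → ℕ → ℤ
  edge n t = q^ ((d ℕ.+ t) ℕ.* (d ℕ.+ t)) * binom (2 ℕ.* n) (n ℕ.+ (d ℕ.+ t))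

  -- q^C(j+1,2) q^C(j,2) = q^(j²) turns the tail certificate into a difference of edges
  tailCert-edge : ∀ n t → q^ (triangular (suc (d ℕ.+ t))) * (0ℤ - tailCert n (suc (d ℕ.+ t)))
                          ≡ q^ n * (1ℤ + x * q^ n) * (oddFactor n * (edge n t - edge n (suc t)))
  tailCert-edge n t = begin
    q^ (triangular (suc j)) * (0ℤ - tailCert n (suc j))
      ≡⟨ lemma (q^ (triangular (suc j))) (q^ (triangular j)) Q x (q^ (suc (2 ℕ.* j))) (binom (suc (2 ℕ.* n)) (n ℕ.+ suc j)) ⟩
    Q * (1ℤ + x * Q) * (q^ (triangular (suc j)) * q^ (triangular j) * (1ℤ - q^ (suc (2 ℕ.* j))) * binom (suc (2 ℕ.* n)) (n ℕ.+ suc j))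
      ≡⟨ cong₂ (λ u v → Q * (1ℤ + x * Q) * (u * (1ℤ - v) * binom (suc (2 ℕ.* n)) (n ℕ.+ suc j)))
               square (q^-1+2* j) ⟩
    Q * (1ℤ + x * Q) * (R * (1ℤ - P * P * x) * binom (suc (2 ℕ.* n)) (n ℕ.+ suc j))
      ≡⟨ cong (λ w → Q * (1ℤ + x * Q) * (R * (1ℤ - P * P * x) * w))
              (trans (cong (binom (suc (2 ℕ.* n))) (ℕ.+-suc n j)) (pascal-row n j)) ⟩
    Q * (1ℤ + x * Q) * (R * (1ℤ - P * P * x) * (Z₁ + Q * P * x * Z₂))
      ≡⟨ cong (Q * (1ℤ + x * Q) *_) (wz-identity₃ x Q P R Z₁ Z₂ (binom-ratio-row n j) (ratio-factor≢0 n j)) ⟩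
    Q * (1ℤ + x * Q) * ((1ℤ - Q * Q * x) * (R * Z₁ - R * P * P * x * Z₂))
      ≡⟨ cong₂ (λ u v → Q * (1ℤ + x * Q) * (u * (R * Z₁ - v))) (cong (λ u → 1ℤ - u * x) (sym (q^-2* n))) (sym edge-suc) ⟩
    Q * (1ℤ + x * Q) * (oddFactor n * (edge n t - edge n (suc t))) ∎
    where
    open ≡-Reasoning
    j = d ℕ.+ t
    Q = q^ n
    P = q^ j
    R = q^ (j ℕ.* j)
    Z₁ = binom (2 ℕ.* n) (n ℕ.+ j)
    Z₂ = binom (2 ℕ.* n) (suc (n ℕ.+ j))
    lemma : ∀ a b Q x T Y → a * (0ℤ - b * Q * (1ℤ + x * Q) * (T - 1ℤ) * Y) ≡ Q * (1ℤ + x * Q) * (a * b * (1ℤ - T) * Y)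
    lemma = solve-∀
    square : q^ (triangular (suc j)) * q^ (triangular j) ≡ R
    square = trans (sym (q^-+ (triangular (suc j)) (triangular j))) (cong q^ (triangular-suc+triangular j))
    edge-suc : edge n (suc t) ≡ R * P * P * x * Z₂
    edge-suc = trans (cong (λ u → q^ (u ℕ.* u) * binom (2 ℕ.* n) (n ℕ.+ u)) (ℕ.+-suc d t))
      (cong₂ _*_ (trans (cong q^ (expand j)) (trans (q^-+ (j ℕ.* j ℕ.+ (j ℕ.+ j)) 1)
                   (trans (cong (_* q^ 1) (trans (q^-+ (j ℕ.* j) (j ℕ.+ j)) (cong (R *_) (q^-+ j j))))
                          (lemma′ R P x))))
                 (cong (binom (2 ℕ.* n)) (ℕ.+-suc n j)))
      where
      expand : ∀ j → suc j ℕ.* suc j ≡ j ℕ.* j ℕ.+ (j ℕ.+ j) ℕ.+ 1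
      expand = ℕ-Solver.solve-∀
      lemma′ : ∀ r t x → r * (t * t) * (1ℤ * x) ≡ r * t * t * x
      lemma′ = solve-∀

  tail-beyond : ∀ n k → n ℕ.< k → tail n k ≡ 0ℤ
  tail-beyond n k n<k = ∑-zero (n ℕ.+ 2) λ s _ →
    *-binom-over (weight (k ℕ.+ s)) (2 ℕ.* n) _ (subst (ℕ._≤ n ℕ.+ (k ℕ.+ s)) (sym (index n))
                                                   (ℕ.+-monoʳ-≤ n (ℕ.≤-trans n<k (ℕ.m≤m+n k s))))
    where index : ∀ n → suc (2 ℕ.* n) ≡ n ℕ.+ suc n
          index = ℕ-Solver.solve-∀

  rhs-telescoped : ∀ n → oddFactor n * (rhs (suc n) - growth n * rhs n)
                         ≡ q^ n * (1ℤ + x * q^ n) * (oddFactor n * (edge n 0 - edge n (suc n)))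
  rhs-telescoped n = begin
    oddFactor n * (rhs (suc n) - growth n * rhs n)
      ≡⟨ cong (λ u → oddFactor n * (u - growth n * rhs n))
              (trans (cong (λ u → ∑ (suc n) term′ + u) last≡0) (ℤ.+-identityʳ (∑ (suc n) term′))) ⟩
    oddFactor n * (∑ (suc n) term′ - growth n * ∑ (suc n) term)
      ≡⟨ ∑-linear (suc n) (oddFactor n) (growth n) term′ term ⟨
    ∑ (suc n) (λ t → oddFactor n * (term′ t - growth n * term t))
      ≡⟨ ∑-cong (suc n) (λ t _ → per t) ⟩
    ∑ (suc n) (λ t → c * (oddFactor n * (edge n t - edge n (suc t))))
      ≡⟨ ∑-*ˡ (suc n) c (λ t → oddFactor n * (edge n t - edge n (suc t))) ⟩
    c * ∑ (suc n) (λ t → oddFactor n * (edge n t - edge n (suc t)))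
      ≡⟨ cong (c *_) (trans (∑-*ˡ (suc n) (oddFactor n) (λ t → edge n t - edge n (suc t)))
                            (cong (oddFactor n *_) (∑-telescope′ (suc n) (edge n)))) ⟩
    c * (oddFactor n * (edge n 0 - edge n (suc n))) ∎
    where
    open ≡-Reasoning
    c = q^ n * (1ℤ + x * q^ n)
    term′ = λ t → q^ (triangular (suc (d ℕ.+ t))) * tail (suc n) (suc (d ℕ.+ t))
    term = λ t → q^ (triangular (suc (d ℕ.+ t))) * tail n (suc (d ℕ.+ t))
    last≡0 : term′ (suc n) ≡ 0ℤ
    last≡0 = trans (cong (q^ (triangular (suc (d ℕ.+ suc n))) *_) (tail-beyond (suc n) _ (s≤s (ℕ.m≤n+m (suc n) d))))
                   (ℤ.*-zeroʳ (q^ (triangular (suc (d ℕ.+ suc n)))))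
    per : ∀ t → oddFactor n * (term′ t - growth n * term t) ≡ c * (oddFactor n * (edge n t - edge n (suc t)))
    per t = trans (lemma (oddFactor n) (q^ (triangular (suc (d ℕ.+ t)))) (tail (suc n) (suc (d ℕ.+ t)))
                         (growth n) (tail n (suc (d ℕ.+ t))))
                  (trans (cong (q^ (triangular (suc (d ℕ.+ t))) *_) (tail-suc n (d ℕ.+ t))) (tailCert-edge n t))
      where lemma : ∀ X a u c v → X * (a * u - c * (a * v)) ≡ a * (X * (u - c * v))
            lemma = solve-∀

  rhs-suc : ∀ n → rhs (suc n) ≡ growth n * rhs n + q^ n * (1ℤ + x * q^ n) * (q^ (d ℕ.* d) * binom (2 ℕ.* n) (n ℕ.+ d))
  rhs-suc n = trans (sym (lemma (rhs (suc n)) (growth n * rhs n))) (cong (λ u → growth n * rhs n + u) difference)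
    where
    lemma : ∀ u v → v + (u - v) ≡ u
    lemma = solve-∀
    edge-end : edge n (suc n) ≡ 0ℤ
    edge-end = *-binom-over (q^ ((d ℕ.+ suc n) ℕ.* (d ℕ.+ suc n))) (2 ℕ.* n) _ (m+[1+n]≡o⇒m<o d (index n d))
      where index : ∀ n d → 2 ℕ.* n ℕ.+ suc d ≡ n ℕ.+ (d ℕ.+ suc n)
            index = ℕ-Solver.solve-∀
    edge-start : edge n 0 ≡ q^ (d ℕ.* d) * binom (2 ℕ.* n) (n ℕ.+ d)
    edge-start = cong (λ u → q^ (u ℕ.* u) * binom (2 ℕ.* n) (n ℕ.+ u)) (ℕ.+-identityʳ d)
    difference : rhs (suc n) - growth n * rhs n ≡ q^ n * (1ℤ + x * q^ n) * (q^ (d ℕ.* d) * binom (2 ℕ.* n) (n ℕ.+ d))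
    difference = *-cancelˡ (1-q^suc≢0 (2 ℕ.* n))
      (trans (rhs-telescoped n)
        (trans (cong₂ (λ u v → q^ n * (1ℤ + x * q^ n) * (oddFactor n * (u - v))) edge-start edge-end)
               (lemma′ (q^ n * (1ℤ + x * q^ n)) (oddFactor n) (q^ (d ℕ.* d) * binom (2 ℕ.* n) (n ℕ.+ d)))))
      where lemma′ : ∀ a b c → a * (b * (c - 0ℤ)) ≡ b * (a * c)
            lemma′ = solve-∀

  rhs-d : rhs d ≡ 0ℤ
  rhs-d = ∑-zero (suc d) λ t _ → trans (cong (q^ (triangular (suc (d ℕ.+ t))) *_) (tail-beyond d _ (s≤s (ℕ.m≤m+n d t))))
                                       (ℤ.*-zeroʳ (q^ (triangular (suc (d ℕ.+ t)))))

  lhs≡rhs : ∀ r → (1ℤ + q^ (d ℕ.+ r)) * q^ (d ℕ.* d) * lhs (λ a → a * a) (d ℕ.+ r) ≡ rhs (d ℕ.+ r)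
  lhs≡rhs zero = subst (λ m → (1ℤ + q^ m) * q^ (d ℕ.* d) * lhs (λ a → a * a) m ≡ rhs m) (sym (ℕ.+-identityʳ d))
    (trans (cong ((1ℤ + q^ d) * q^ (d ℕ.* d) *_) (lhs-d (λ a → a * a))) (trans (ℤ.*-zeroʳ ((1ℤ + q^ d) * q^ (d ℕ.* d))) (sym rhs-d)))
  lhs≡rhs (suc r) = subst (λ m → (1ℤ + q^ m) * q^ (d ℕ.* d) * lhs (λ a → a * a) m ≡ rhs m) (sym (ℕ.+-suc d r)) (begin
    (1ℤ + q^ (suc n)) * D * lhs (λ a → a * a) (suc n)
      ≡⟨ cong ((1ℤ + q^ (suc n)) * D *_) (lhs-suc (λ a → a * a) (λ a b → interchange a b) refl n) ⟩
    (1ℤ + q^ (suc n)) * D * ((1ℤ + q^ n) * (1ℤ + q^ n) * lhs (λ a → a * a) n + q^ n * binom (2 ℕ.* n) (n ℕ.+ d))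
      ≡⟨ lemma (q^ n) x D (lhs (λ a → a * a) n) (binom (2 ℕ.* n) (n ℕ.+ d)) ⟩
    growth n * ((1ℤ + q^ n) * D * lhs (λ a → a * a) n) + q^ n * (1ℤ + x * q^ n) * (D * binom (2 ℕ.* n) (n ℕ.+ d))
      ≡⟨ cong (λ u → growth n * u + q^ n * (1ℤ + x * q^ n) * (D * binom (2 ℕ.* n) (n ℕ.+ d))) (lhs≡rhs r) ⟩
    growth n * rhs n + q^ n * (1ℤ + x * q^ n) * (D * binom (2 ℕ.* n) (n ℕ.+ d))
      ≡⟨ rhs-suc n ⟨
    rhs (suc n) ∎)
    where
    open ≡-Reasoning
    n = d ℕ.+ r
    D = q^ (d ℕ.* d)
    interchange : ∀ a b → a * b * (a * b) ≡ a * a * (b * b)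
    interchange = solve-∀
    lemma : ∀ Q x D A B → (1ℤ + Q * x) * D * ((1ℤ + Q) * (1ℤ + Q) * A + Q * B)
                         ≡ (1ℤ + x * Q) * (1ℤ + Q) * ((1ℤ + Q) * D * A) + Q * (1ℤ + x * Q) * (D * B)
    lemma = solve-∀

m<n∸o⇒m+o<n : ∀ m n o → m ℕ.< n ∸ o → m ℕ.+ o ℕ.< n
m<n∸o⇒m+o<n m n zero m<n rewrite ℕ.+-identityʳ m = m<n
m<n∸o⇒m+o<n m (suc n) (suc o) m<n∸o rewrite ℕ.+-suc m o = s≤s (m<n∸o⇒m+o<n m n o m<n∸o)

m∸n≤o⇒m≤o+n : ∀ m n o → m ∸ n ℕ.≤ o → m ℕ.≤ o ℕ.+ n
m∸n≤o⇒m≤o+n m n o m∸n≤o = ℕ.≤-trans (ℕ.m≤n+m∸n m n) (subst (n ℕ.+ (m ∸ n) ℕ.≤_) (ℕ.+-comm n o) (ℕ.+-monoʳ-≤ n m∸n≤o))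

[2*w-2]/2≡w-1 : ∀ w → (+ (2 ℕ.* w) - + 2) /ℕ 2 ≡ + w - + 1
[2*w-2]/2≡w-1 zero = refl
[2*w-2]/2≡w-1 (suc w) = trans (cong (_/ℕ 2) numerator) (trans (cong +_ (trans (cong (ℕ._/ 2) (ℕ.*-comm 2 w)) (m*n/n≡m w 2)))
                                                             (sym (ℤ.m-n≡m⊖n (suc w) 1)))
  where
  2*[1+w] : ∀ w → 2 ℕ.* suc w ≡ 2 ℕ.* w ℕ.+ 2
  2*[1+w] = ℕ-Solver.solve-∀
  numerator : + (2 ℕ.* suc w) - + 2 ≡ + (2 ℕ.* w)
  numerator = trans (cong (λ u → + u - + 2) (2*[1+w] w))
                    (trans (ℤ.m-n≡m⊖n (2 ℕ.* w ℕ.+ 2) 2) (trans (ℤ.⊖-≥ (ℕ.m≤n+m 2 (2 ℕ.* w))) (cong +_ (ℕ.m+n∸n≡m (2 ℕ.* w) 2))))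

-- with both sides moved so that no subtraction occurs in ℕ
numerator₂ : ∀ (J K A jj kk : ℕ) → jj ℕ.+ kk ℕ.+ 2 ≡ 2 ℕ.* A ℕ.+ 3 ℕ.* J ℕ.+ K →
             + jj - (+ 3) * + J + + kk - + K ≡ + (2 ℕ.* A) - + 2
numerator₂ J K A jj kk eq = begin
  + jj - (+ 3) * + J + + kk - + K
    ≡⟨ lemma (+ jj) (+ J) (+ kk) (+ K) (+ A) ⟩
  (+ 2) * + A - + 2 + ((+ jj + + kk + + 2) - ((+ 2) * + A + (+ 3) * + J + + K))
    ≡⟨ cong (λ v → (+ 2) * + A - + 2 + ((+ jj + + kk + + 2) - v)) (sym rhs-cast) ⟩
  (+ 2) * + A - + 2 + (+ (jj ℕ.+ kk ℕ.+ 2) - + (2 ℕ.* A ℕ.+ 3 ℕ.* J ℕ.+ K))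
    ≡⟨ cong (λ u → (+ 2) * + A - + 2 + (+ u - + (2 ℕ.* A ℕ.+ 3 ℕ.* J ℕ.+ K))) eq ⟩
  (+ 2) * + A - + 2 + (+ (2 ℕ.* A ℕ.+ 3 ℕ.* J ℕ.+ K) - + (2 ℕ.* A ℕ.+ 3 ℕ.* J ℕ.+ K))
    ≡⟨ cong (λ u → (+ 2) * + A - + 2 + u) (ℤ.+-inverseʳ (+ (2 ℕ.* A ℕ.+ 3 ℕ.* J ℕ.+ K))) ⟩
  (+ 2) * + A - + 2 + 0ℤ
    ≡⟨ trans (ℤ.+-identityʳ ((+ 2) * + A - + 2)) (cong (_- + 2) (sym (ℤ.pos-* 2 A))) ⟩
  + (2 ℕ.* A) - + 2 ∎
  where
  open ≡-Reasoning
  lemma : ∀ jj J kk K A → jj - (+ 3) * J + kk - K ≡ (+ 2) * A - + 2 + ((jj + kk + + 2) - ((+ 2) * A + (+ 3) * J + K))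
  lemma = solve-∀
  rhs-cast : + (2 ℕ.* A ℕ.+ 3 ℕ.* J ℕ.+ K) ≡ (+ 2) * + A + (+ 3) * + J + + K
  rhs-cast = trans (ℤ.pos-+ (2 ℕ.* A ℕ.+ 3 ℕ.* J) K)
                   (cong (_+ + K) (trans (ℤ.pos-+ (2 ℕ.* A) (3 ℕ.* J)) (cong₂ _+_ (ℤ.pos-* 2 A) (ℤ.pos-* 3 J))))

secondLhs secondRhs : ℕ → ℕ → Frac
secondRhsTerm : ℕ → ℕ → ℕ → ℕ → Frac
secondLhs n d = sumTo n (λ k → qpowℕ k *F qBinom (2 ℕ.* k) (k ℕ.+ d)
                               *F (qPoch (-F qpowℕ (k ℕ.+ 1)) (n ∸ 1 ∸ k) *F qPoch (-F qpowℕ (k ℕ.+ 1)) (n ∸ 1 ∸ k)))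
secondRhsTerm n d k j =
  qpow ((((+ (j ℕ.* j) - (+ 3) * + j + + (k ℕ.* k) - + k) /ℕ 2) - + (d ℕ.* d)) + + 1)
  *F ((1F +F qpowℕ (j ∸ 1)) ÷F (1F +F qpowℕ n))
  *F qBinom (2 ℕ.* n) (n ℕ.+ 1 ∸ j)
secondRhs n d = sumFromTo (d ℕ.+ 1) n (λ k → sumFromTo (k ℕ.+ 1) (n ℕ.+ 1) (secondRhsTerm n d k))

module SecondIdentityAtPoint (N' n d : ℕ) where
  open AtPoint N'
  open LeftSides N' d
  open SecondIdentity N' d

  -- the (k, j = m + 1) term of the double sum, multiplied by 1 + q^n
  exponent : ℕ → ℕ → ℕ
  exponent k m = triangular m ℕ.+ triangular k ∸ d ℕ.* d

  innerValue : ℕ → ℕ → ℤ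
  innerValue k m = q^ (exponent k m) * (1ℤ + q^ m) * binom (2 ℕ.* n) (n ℕ.+ m)

  exponent≡ : ∀ k m → d ℕ.< k → k ℕ.≤ m →
    (((+ (suc m ℕ.* suc m) - (+ 3) * + suc m + + (k ℕ.* k) - + k) /ℕ 2) - + (d ℕ.* d)) + + 1 ≡ + exponent k m
  exponent≡ k m d<k k≤m = begin
    (((+ (suc m ℕ.* suc m) - (+ 3) * + suc m + + (k ℕ.* k) - + k) /ℕ 2) - + (d ℕ.* d)) + + 1
      ≡⟨ cong (λ u → ((u /ℕ 2) - + (d ℕ.* d)) + + 1) (numerator₂ (suc m) k w (suc m ℕ.* suc m) (k ℕ.* k) arithmetic) ⟩
    (((+ (2 ℕ.* w) - + 2) /ℕ 2) - + (d ℕ.* d)) + + 1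
      ≡⟨ cong (λ u → (u - + (d ℕ.* d)) + + 1) ([2*w-2]/2≡w-1 w) ⟩
    ((+ w - + 1) - + (d ℕ.* d)) + + 1
      ≡⟨ lemma (+ w) (+ (d ℕ.* d)) ⟩
    + w - + (d ℕ.* d)
      ≡⟨ trans (ℤ.m-n≡m⊖n w (d ℕ.* d)) (ℤ.⊖-≥ (d*d≤triangular+triangular d k m d<k (ℕ.<-≤-trans d<k k≤m))) ⟩
    + exponent k m ∎
    where
    open ≡-Reasoning
    w = triangular m ℕ.+ triangular k
    expand : ∀ m k → suc m ℕ.* suc m ℕ.+ k ℕ.* k ℕ.+ 2 ≡ m ℕ.* m ℕ.+ k ℕ.* k ℕ.+ 2 ℕ.* m ℕ.+ 3
    expand = ℕ-Solver.solve-∀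
    collect : ∀ a b m k → (2 ℕ.* a ℕ.+ m) ℕ.+ (2 ℕ.* b ℕ.+ k) ℕ.+ 2 ℕ.* m ℕ.+ 3 ≡ 2 ℕ.* (a ℕ.+ b) ℕ.+ 3 ℕ.* suc m ℕ.+ k
    collect = ℕ-Solver.solve-∀
    arithmetic : suc m ℕ.* suc m ℕ.+ k ℕ.* k ℕ.+ 2 ≡ 2 ℕ.* w ℕ.+ 3 ℕ.* suc m ℕ.+ k
    arithmetic = trans (expand m k)
      (trans (cong₂ (λ u v → u ℕ.+ v ℕ.+ 2 ℕ.* m ℕ.+ 3) (m*m≡2*triangular+m m) (m*m≡2*triangular+m k))
             (collect (triangular m) (triangular k) m k))
    lemma : ∀ a b → ((a - 1ℤ) - b) + 1ℤ ≡ a - b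
    lemma = solve-∀

  evaluates-secondRhsTerm : ∀ k m → d ℕ.< k → k ℕ.≤ m → m ℕ.≤ n →
                            Evaluates (secondRhsTerm n d k (suc m)) (innerValue k m) (1ℤ + q^ n)
  evaluates-secondRhsTerm k m d<k k≤m m≤n = evaluates-rescale value (regroup (q^ (exponent k m)) (1ℤ + q^ m) B (1ℤ + q^ n)) (1+q^≢0 n)
    where
    B = binom (2 ℕ.* n) (n ℕ.+ m)
    reflected : 2 ℕ.* n ∸ (n ℕ.+ 1 ∸ suc m) ≡ n ℕ.+ m
    reflected = trans (cong (λ u → 2 ℕ.* n ∸ (u ∸ suc m)) (ℕ.+-comm n 1))
                 (trans (cong (_∸ (n ∸ m)) (cong (n ℕ.+_) (ℕ.+-identityʳ n)))
                   (trans (ℕ.+-∸-assoc n (ℕ.m∸n≤m n m)) (cong (n ℕ.+_) (ℕ.m∸[m∸n]≡n m≤n))))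
    n+1∸[1+m]≤2n : n ℕ.+ 1 ∸ suc m ℕ.≤ 2 ℕ.* n
    n+1∸[1+m]≤2n = subst (λ u → u ∸ suc m ℕ.≤ 2 ℕ.* n) (ℕ.+-comm 1 n) (ℕ.≤-trans (ℕ.m∸n≤m n m) (ℕ.m≤m+n n (n ℕ.+ 0)))
    value = evaluates-*F
              (evaluates-*F
                (subst (λ e → EvaluatesToℤ (qpow e) (q^ (exponent k m))) (sym (exponent≡ k m d<k k≤m))
                       (evaluates-qpowℕ (exponent k m)))
                (evaluates-÷F (evaluatesℤ-+F (evaluates-fromℤ 1ℤ) (evaluates-qpowℕ m))
                              (evaluatesℤ-+F (evaluates-fromℤ 1ℤ) (evaluates-qpowℕ n)) (1+q^≢0 n)))
              (evaluates-≡ (evaluates-qBinom (2 ℕ.* n) (n ℕ.+ 1 ∸ suc m))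
                           (trans (binom-symmetric (2 ℕ.* n) (n ℕ.+ 1 ∸ suc m) n+1∸[1+m]≤2n) (cong (binom (2 ℕ.* n)) reflected)))
    regroup : ∀ a b c D → a * (b * 1ℤ) * c * D ≡ a * b * c * (1ℤ * (1ℤ * D) * 1ℤ)
    regroup = solve-∀

  innerLength : ℕ → ℕ
  innerLength k = suc (n ℕ.+ 1) ∸ (k ℕ.+ 1)

  innerSum : ℕ → ℤ
  innerSum k = ∑ (innerLength k) (λ t → innerValue k (k ℕ.+ t))

  evaluates-inner : ∀ k → d ℕ.< k → Evaluates (sumFromTo (k ℕ.+ 1) (n ℕ.+ 1) (secondRhsTerm n d k)) (innerSum k) (1ℤ + q^ n)
  evaluates-inner k d<k = evaluates-sumTo (innerLength k) (1+q^≢0 n) λ t t<len →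
    subst (λ j → Evaluates (secondRhsTerm n d k j) (innerValue k (k ℕ.+ t)) (1ℤ + q^ n)) (sym (index k t))
          (evaluates-secondRhsTerm k (k ℕ.+ t) d<k (ℕ.m≤m+n k t) (k+t≤n t t<len))
    where
    index : ∀ k t → k ℕ.+ 1 ℕ.+ t ≡ suc (k ℕ.+ t)
    index = ℕ-Solver.solve-∀
    k+t≤n : ∀ t → t ℕ.< innerLength k → k ℕ.+ t ℕ.≤ n
    k+t≤n t t<len = ℕ.≤-pred (subst (suc (k ℕ.+ t) ℕ.≤_) (ℕ.+-comm n 1)
                      (ℕ.≤-pred (subst (ℕ._< suc (n ℕ.+ 1)) (index′ k t) (m<n∸o⇒m+o<n t (suc (n ℕ.+ 1)) (k ℕ.+ 1) t<len))))
      where index′ : ∀ k t → t ℕ.+ (k ℕ.+ 1) ≡ suc (k ℕ.+ t)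
            index′ = ℕ-Solver.solve-∀

  outerSum : ℤ
  outerSum = ∑ (suc n ∸ (d ℕ.+ 1)) (λ i → innerSum (d ℕ.+ 1 ℕ.+ i))

  evaluates-secondRhs : Evaluates (secondRhs n d) outerSum (1ℤ + q^ n)
  evaluates-secondRhs = evaluates-sumTo (suc n ∸ (d ℕ.+ 1)) (1+q^≢0 n) λ i _ →
    evaluates-inner (d ℕ.+ 1 ℕ.+ i) (ℕ.≤-trans (ℕ.≤-reflexive (ℕ.+-comm 1 d)) (ℕ.m≤m+n (d ℕ.+ 1) i))

  evaluates-secondLhs : EvaluatesToℤ (secondLhs n d) (lhs (λ a → a * a) n)
  evaluates-secondLhs = evaluates-sumTo n 1≢0 λ k _ →
    evaluatesℤ-*F (evaluatesℤ-*F (evaluates-qpowℕ k) (evaluates-qBinom (2 ℕ.* k) (k ℕ.+ d)))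
                  (evaluatesℤ-*F (evaluates-qPoch (evaluates--F (evaluates-qpowℕ (k ℕ.+ 1))) (n ∸ 1 ∸ k))
                                 (evaluates-qPoch (evaluates--F (evaluates-qpowℕ (k ℕ.+ 1))) (n ∸ 1 ∸ k)))

  innerSum≡tail : ∀ k → d ℕ.< k → q^ (d ℕ.* d) * innerSum k ≡ q^ (triangular k) * tail n k
  innerSum≡tail k d<k = begin
    q^ (d ℕ.* d) * innerSum k                          ≡⟨ ∑-*ˡ (innerLength k) (q^ (d ℕ.* d)) (λ t → innerValue k (k ℕ.+ t)) ⟨
    ∑ (innerLength k) (λ t → q^ (d ℕ.* d) * innerValue k (k ℕ.+ t))
                                                       ≡⟨ ∑-cong (innerLength k) (λ t _ → per t) ⟩
    ∑ (innerLength k) (λ t → q^ (triangular k) * term t) ≡⟨ ∑-*ˡ (innerLength k) (q^ (triangular k)) term ⟩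
    q^ (triangular k) * ∑ (innerLength k) term          ≡⟨ cong (q^ (triangular k) *_) (∑-extend (innerLength k) (n ℕ.+ 2) length≤ beyond) ⟩
    q^ (triangular k) * tail n k                        ∎
    where
    open ≡-Reasoning
    term = λ t → weight (k ℕ.+ t) * binom (2 ℕ.* n) (n ℕ.+ (k ℕ.+ t))
    per : ∀ t → q^ (d ℕ.* d) * innerValue k (k ℕ.+ t) ≡ q^ (triangular k) * term t
    per t = trans (lemma (q^ (d ℕ.* d)) (q^ (exponent k m)) (1ℤ + q^ m) (binom (2 ℕ.* n) (n ℕ.+ m)))
              (trans (cong (λ u → u * (1ℤ + q^ m) * binom (2 ℕ.* n) (n ℕ.+ m))
                           (trans (sym (q^-+ (d ℕ.* d) (exponent k m))) (trans (cong q^ exponent-sum) (q^-+ (triangular m) (triangular k)))))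
                     (lemma′ (q^ (triangular m)) (q^ (triangular k)) (1ℤ + q^ m) (binom (2 ℕ.* n) (n ℕ.+ m))))
      where
      m = k ℕ.+ t
      exponent-sum : d ℕ.* d ℕ.+ exponent k m ≡ triangular m ℕ.+ triangular k
      exponent-sum = ℕ.m+[n∸m]≡n (d*d≤triangular+triangular d k m d<k (ℕ.<-≤-trans d<k (ℕ.m≤m+n k t)))
      lemma : ∀ P a b c → P * (a * b * c) ≡ (P * a) * b * c
      lemma = solve-∀
      lemma′ : ∀ a b c e → (a * b) * c * e ≡ b * (a * c * e)
      lemma′ = solve-∀
    length≤ : innerLength k ℕ.≤ n ℕ.+ 2
    length≤ = ℕ.≤-trans (ℕ.m∸n≤m (suc (n ℕ.+ 1)) (k ℕ.+ 1)) (ℕ.≤-reflexive (index n))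
      where index : ∀ n → suc (n ℕ.+ 1) ≡ n ℕ.+ 2
            index = ℕ-Solver.solve-∀
    beyond : ∀ t → innerLength k ℕ.≤ t → t ℕ.< n ℕ.+ 2 → term t ≡ 0ℤ
    beyond t len≤t _ = *-binom-over (weight (k ℕ.+ t)) (2 ℕ.* n) _
      (subst (ℕ._≤ n ℕ.+ (k ℕ.+ t)) (sym (index n)) (ℕ.+-monoʳ-≤ n n<k+t))
      where
      index : ∀ n → suc (2 ℕ.* n) ≡ n ℕ.+ suc n
      index = ℕ-Solver.solve-∀
      index′ : ∀ t k → t ℕ.+ (k ℕ.+ 1) ≡ suc (k ℕ.+ t)
      index′ = ℕ-Solver.solve-∀
      n<k+t : suc n ℕ.≤ k ℕ.+ t
      n<k+t = subst (ℕ._≤ k ℕ.+ t) (ℕ.+-comm n 1)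
                (ℕ.≤-pred (subst (suc (n ℕ.+ 1) ℕ.≤_) (index′ t k) (m∸n≤o⇒m≤o+n (suc (n ℕ.+ 1)) (k ℕ.+ 1) t len≤t)))

  outerSum≡rhs : q^ (d ℕ.* d) * outerSum ≡ rhs n
  outerSum≡rhs = begin
    q^ (d ℕ.* d) * outerSum
      ≡⟨ ∑-*ˡ (suc n ∸ (d ℕ.+ 1)) (q^ (d ℕ.* d)) (λ i → innerSum (d ℕ.+ 1 ℕ.+ i)) ⟨
    ∑ (suc n ∸ (d ℕ.+ 1)) (λ i → q^ (d ℕ.* d) * innerSum (d ℕ.+ 1 ℕ.+ i))
      ≡⟨ ∑-extend (suc n ∸ (d ℕ.+ 1)) (suc n) (ℕ.m∸n≤m (suc n) (d ℕ.+ 1)) beyond ⟩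
    ∑ (suc n) (λ i → q^ (d ℕ.* d) * innerSum (d ℕ.+ 1 ℕ.+ i))
      ≡⟨ ∑-cong (suc n) (λ i _ → trans (cong (λ k → q^ (d ℕ.* d) * innerSum k) (index d i))
                                         (innerSum≡tail (suc (d ℕ.+ i)) (s≤s (ℕ.m≤m+n d i)))) ⟩
    rhs n ∎
    where
    open ≡-Reasoning
    index : ∀ d i → d ℕ.+ 1 ℕ.+ i ≡ suc (d ℕ.+ i)
    index = ℕ-Solver.solve-∀
    beyond : ∀ i → suc n ∸ (d ℕ.+ 1) ℕ.≤ i → i ℕ.< suc n → q^ (d ℕ.* d) * innerSum (d ℕ.+ 1 ℕ.+ i) ≡ 0ℤ
    beyond i len≤i _ = trans (cong (λ L → q^ (d ℕ.* d) * ∑ L (λ t → innerValue (d ℕ.+ 1 ℕ.+ i) (d ℕ.+ 1 ℕ.+ i ℕ.+ t))) empty)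
                             (ℤ.*-zeroʳ (q^ (d ℕ.* d)))
      where
      index′ : ∀ i d → i ℕ.+ (d ℕ.+ 1) ℕ.+ 1 ≡ d ℕ.+ 1 ℕ.+ i ℕ.+ 1
      index′ = ℕ-Solver.solve-∀
      empty : innerLength (d ℕ.+ 1 ℕ.+ i) ≡ 0
      empty = ℕ.m≤n⇒m∸n≡0 (subst (suc (n ℕ.+ 1) ℕ.≤_) (index′ i d)
                                 (ℕ.+-monoˡ-≤ 1 (m∸n≤o⇒m≤o+n (suc n) (d ℕ.+ 1) i len≤i)))

  secondIdentity-at : d ℕ.≤ n → eval (crossDifference (secondLhs n d) (secondRhs n d)) x ≡ 0ℤ
  secondIdentity-at d≤n = evaluates-crossDifference evaluates-secondLhs evaluates-secondRhs
    (*-cancelˡ (q^≢0 (d ℕ.* d)) (begin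
      q^ (d ℕ.* d) * (lhs (λ a → a * a) n * (1ℤ + q^ n))
        ≡⟨ lemma (q^ (d ℕ.* d)) (lhs (λ a → a * a) n) (q^ n) ⟩
      (1ℤ + q^ n) * q^ (d ℕ.* d) * lhs (λ a → a * a) n
        ≡⟨ subst (λ m → (1ℤ + q^ m) * q^ (d ℕ.* d) * lhs (λ a → a * a) m ≡ rhs m) (ℕ.m+[n∸m]≡n d≤n) (lhs≡rhs (n ∸ d)) ⟩
      rhs n
        ≡⟨ outerSum≡rhs ⟨
      q^ (d ℕ.* d) * outerSum
        ≡⟨ cong (q^ (d ℕ.* d) *_) (ℤ.*-identityʳ outerSum) ⟨
      q^ (d ℕ.* d) * (outerSum * 1ℤ) ∎))
    where
    open ≡-Reasoning
    lemma : ∀ P A Q → P * (A * (1ℤ + Q)) ≡ (1ℤ + Q) * P * A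
    lemma = solve-∀

theorem1p1 : (n d : ℕ) → 1 ≤ n → d ≤ n ∸ 1 →
    (sumTo n (λ k → qpowℕ k *F qBinom (2 ℕ.* k) (k ℕ.+ d) *F qPoch (-F qpowℕ (k ℕ.+ 1)) (n ∸ 1 ∸ k))
      ≈F
     sumFromTo 0 (n ∸ d) (λ k → when (k % 2 ℕ.≟ (n ∸ d) % 2)
       (sgn ⌊ (n ∸ d ∸ k) /2⌋
        *F qpow (((+ 3) ℤ.* (+ (n ℕ.* n) ℤ.+ + (k ℕ.* k) ℤ.- + (d ℕ.* d))
                  ℤ.- (+ 6) ℤ.* + (n ℕ.* k) ℤ.+ (+ 4) ℤ.* + n ℤ.- (+ 4) ℤ.* + k) /ℕ 4)
        *F (((1F -F qpowℕ k) *F (1F +F qpowℕ (n ∸ k ℕ.+ 1)))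
            ÷F ((1F -F qpowℕ (2 ℕ.* n ∸ k ℕ.+ 1)) *F (1F +F qpowℕ n)))
        *F qBinom (2 ℕ.* n) k)))
  × (sumTo n (λ k → qpowℕ k *F qBinom (2 ℕ.* k) (k ℕ.+ d)
                *F (qPoch (-F qpowℕ (k ℕ.+ 1)) (n ∸ 1 ∸ k) *F qPoch (-F qpowℕ (k ℕ.+ 1)) (n ∸ 1 ∸ k)))
      ≈F
     sumFromTo (d ℕ.+ 1) n (λ k → sumFromTo (k ℕ.+ 1) (n ℕ.+ 1) (λ j →
       qpow ((((+ (j ℕ.* j) ℤ.- (+ 3) ℤ.* + j ℤ.+ + (k ℕ.* k) ℤ.- + k) /ℕ 2)
              ℤ.- + (d ℕ.* d)) ℤ.+ + 1)
       *F ((1F +F qpowℕ (j ∸ 1)) ÷F (1F +F qpowℕ n))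
       *F qBinom (2 ℕ.* n) (n ℕ.+ 1 ∸ j))))
theorem1p1 n d _ d≤n∸1 =
    vanishesFrom⇒isZero _ _ ℕ.≤-refl (+ 2) (λ N' → FirstIdentityAtPoint.firstIdentity-at N' n d d≤n)
  , vanishesFrom⇒isZero _ _ ℕ.≤-refl (+ 2) (λ N' → SecondIdentityAtPoint.secondIdentity-at N' n d d≤n)
  where
  d≤n : d ≤ n
  d≤n = ℕ.≤-trans d≤n∸1 (ℕ.m∸n≤m n 1)
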